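{- Let $N=(A,\mathfrak{C})$ be a regular oriented matroid. Then: (i) $\mathcal{A}_N(q,y,z)=\mathcal{A}_N(q,z,y)$; (ii) for every odd positive integer $q$, $\sum_{f\in F_N(q)}x^{|f_A^=|}y^{|f_A^>|}z^{|f_A^<|}=x^{|A|}\mathcal{A}_N(q,y/x,z/x)$; (iii) for every odd positive integer $q$, $\sum_{f\in F_N(q)}y^{|f_A^\geq|}z^{|f_A^\leq|}=(yz)^{|A|}\mathcal{A}_N(q,1/y,1/z)$; (iv) if $A=\emptyset$ then $\mathcal{A}_N(q,y,z)=1$; (v) if $a\in A$ is a loop then $\mathcal{A}_N=\mathcal{A}_{N_{\setminus a}}$; (vi) if $a\in A$ is a coloop then $\mathcal{A}_N(q,y,z)=\left(1+\frac{q-1}{2}(y+z)\right)\mathcal{A}_{N_{/a}}(q,y,z)$; (vii) if $N$ is the disjoint union of two regular oriented matroids $N_1$ and $N_2$ then $\mathcal{A}_N=\mathcal{A}_{N_1}\mathcal{A}_{N_2}$.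
   Context: An oriented matroid $N=(A,\mathfrak{C})$ has finite ground set $A$ and set of signed circuits $\mathfrak{C}$, each $C=(C^+,C^-)$ a pair of disjoint subsets of $A$; it is regular if representable over $\mathbb{R}$ by a totally unimodular matrix. For a positive integer $q$, a $q$-coflow is a map $f:A\to\mathbb{Z}/q\mathbb{Z}$ with $\sum_{a\in C^+}f(a)-\sum_{a\in C^- }f(a)=0$ in $\mathbb{Z}/q\mathbb{Z}$ for all $C\in\mathfrak{C}$; $F_N(q)$ is the set of $q$-coflows. Writing "$x\in S$" for $x\in\mathbb{Z}/q\mathbb{Z}$ and $S\subseteq\mathbb{Z}$ to mean $x=s+q\mathbb{Z}$ for some $s\in S$, set $f_A^>=\{a: f(a)\in\{1,\ldots,\lfloor q/2\rfloor\}\}$, $f_A^<=\{a:-f(a)\in\{1,\ldots,\lfloor q/2\rfloor\}\}$, $f_A^==\{a:f(a)=0\}$, $f_A^\geq=f_A^>\cup f_A^=$, $f_A^\leq=f_A^<\cup f_A^=$. The $A$-polynomial $\mathcal{A}_N(q,y,z)$ is the unique polynomial such that $\mathcal{A}_N(q,y,z)=\sum_{f\in F_N(q)}y^{|f_A^>|}z^{|f_A^<|}$ for every odd positive integer $q$. Loops, coloops, deletion $N_{\setminus a}$ and contraction $N_{/a}$ are the standard oriented matroid notions (loop/coloop refer to the underlying matroid). -}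

module Defs where

open import Data.Bool using (Bool; true; false; _∧_; _∨_; not; T; if_then_else_)
open import Data.Nat as ℕ using (ℕ; zero; suc; _≤ᵇ_; _∸_; _/_)
open import Data.Fin using (Fin; zero; suc; toℕ; punchIn)
open import Data.Fin.Properties using () renaming (_≟_ to _≟ᶠ_)
open import Data.Integer as ℤ using (ℤ; +_; +0)
open import Data.Integer.Divisibility.Signed using (_∣?_)
open import Data.Rational as ℚ using (ℚ; 0ℚ; 1ℚ)
open import Data.Vec as Vec using (Vec; []; _∷_; lookup; removeAt; _++_; replicate; toList)
open import Data.List as List using (List; []; _∷_; filter; concatMap; map)
open import Data.Bool.ListAction using (all; any)
open import Data.List.Membership.Propositional using (_∈_)
open import Data.Product using (Σ; Σ-syntax; _×_; _,_; ∃)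
open import Data.Sum using (_⊎_)
open import Function.Definitions using (Injective)
open import Relation.Binary.PropositionalEquality using (_≡_; _≢_)
open import Relation.Nullary.Decidable using (⌊_⌋)

data Sign : Set where
  ⊕ ⊖ ◯ : Sign

isZ : Sign → Bool
isZ ◯ = true
isZ _ = false

-- A sign vector X : Vec Sign n encodes the signed set (X⁺ , X⁻) with
-- X⁺ = {a | X a = ⊕}, X⁻ = {a | X a = ⊖}.
SignVec : ℕ → Set
SignVec n = Vec Sign n

-- Oriented matroids on ground set A = Fin n, given by their (finite)
-- set of signed circuits, listed.

OM : ℕ → Set
OM n = List (SignVec n)

sumFin : (k : ℕ) → (Fin k → ℤ) → ℤ
sumFin zero    f = +0
sumFin (suc k) f = f zero ℤ.+ sumFin k (λ i → f (suc i))

altSign : ℕ → ℤ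
altSign zero    = + 1
altSign (suc i) = ℤ.- altSign i

det : (k : ℕ) → (Fin k → Fin k → ℤ) → ℤ
det zero    M = + 1
det (suc k) M =
  sumFin (suc k) (λ j → altSign (toℕ j) ℤ.* M zero j ℤ.*
                          det k (λ i l → M (suc i) (punchIn j l)))

TotallyUnimodular : {r n : ℕ} → (Fin r → Fin n → ℤ) → Set
TotallyUnimodular {r} {n} M =
  (k : ℕ) (ρ : Fin k → Fin r) (κ : Fin k → Fin n) →
  Injective _≡_ _≡_ ρ → Injective _≡_ _≡_ κ →
  let d = det k (λ i j → M (ρ i) (κ j)) in
  (d ≡ ℤ.- (+ 1)) ⊎ (d ≡ +0) ⊎ (d ≡ + 1)

sgn : ℤ → Sign
sgn (+ zero)    = ◯
sgn (+ (suc _)) = ⊕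
sgn ℤ.-[1+ _ ]  = ⊖

InKernel : {r n : ℕ} → (Fin r → Fin n → ℤ) → (Fin n → ℤ) → Set
InKernel {r} {n} M v = (i : Fin r) → sumFin n (λ j → M i j ℤ.* v j) ≡ +0

IsSignedCircuitOf : {r n : ℕ} → (Fin r → Fin n → ℤ) → SignVec n → Set
IsSignedCircuitOf {r} {n} M X =
  Σ[ v ∈ (Fin n → ℤ) ]
    InKernel M v ×
    ((j : Fin n) → sgn (v j) ≡ lookup X j) ×
    (Σ[ j ∈ Fin n ] v j ≢ +0) ×
    ((w : Fin n → ℤ) → InKernel M w → (Σ[ j ∈ Fin n ] w j ≢ +0) →
       ((j : Fin n) → v j ≡ +0 → w j ≡ +0) →
       ((j : Fin n) → w j ≡ +0 → v j ≡ +0))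

Regular : {n : ℕ} → OM n → Set
Regular {n} N =
  Σ[ r ∈ ℕ ] Σ[ M ∈ (Fin r → Fin n → ℤ) ]
    TotallyUnimodular M ×
    ((X : SignVec n) → (X ∈ N → IsSignedCircuitOf M X) × (IsSignedCircuitOf M X → X ∈ N))

IsLoop : {n : ℕ} → OM n → Fin n → Set
IsLoop {n} N a = Σ[ X ∈ SignVec n ] X ∈ N × (lookup X a ≢ ◯) ×
                  ((b : Fin n) → b ≢ a → lookup X b ≡ ◯)

IsColoop : {n : ℕ} → OM n → Fin n → Set
IsColoop {n} N a = (X : SignVec n) → X ∈ N → lookup X a ≡ ◯

deletion : {m : ℕ} → OM (suc m) → Fin (suc m) → OM m
deletion N a = map (λ X → removeAt X a) (filter (λ X → isZ (lookup X a) Data.Bool.≟ true) N)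
  where import Data.Bool

nonzeroᵇ : {n : ℕ} → SignVec n → Bool
nonzeroᵇ X = any (λ s → not (isZ s)) (toList X)

suppSubᵇ : {n : ℕ} → SignVec n → SignVec n → Bool
suppSubᵇ []       []       = true
suppSubᵇ (x ∷ xs) (y ∷ ys) = (isZ x ∨ not (isZ y)) ∧ suppSubᵇ xs ys

suppStrictᵇ : {n : ℕ} → SignVec n → SignVec n → Bool
suppStrictᵇ X Y = suppSubᵇ X Y ∧ not (suppSubᵇ Y X)

-- Contraction: the inclusion-minimal nonempty members of {C ∖ a | C circuit}.
contraction : {m : ℕ} → OM (suc m) → Fin (suc m) → OM m
contraction N a =
  let cands = filter (λ Y → nonzeroᵇ Y Data.Bool.≟ true) (map (λ X → removeAt X a) N)
  in filter (λ Y → any (λ Z → suppStrictᵇ Z Y) cands Data.Bool.≟ false) cands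
  where import Data.Bool

disjointUnion : {n₁ n₂ : ℕ} → OM n₁ → OM n₂ → OM (n₁ ℕ.+ n₂)
disjointUnion {n₁} {n₂} N₁ N₂ =
  map (λ X → X ++ replicate n₂ ◯) N₁ List.++ map (λ X → replicate n₁ ◯ ++ X) N₂

-- q-coflows.  Elements of ℤ/qℤ are represented by Fin q (residues 0..q-1).

Coflow : ℕ → ℕ → Set
Coflow q n = Vec (Fin q) n

circSum : {q n : ℕ} → SignVec n → Coflow q n → ℤ
circSum []       []       = +0
circSum (⊕ ∷ X)  (x ∷ f)  = + toℕ x ℤ.+ circSum X f
circSum (⊖ ∷ X)  (x ∷ f)  = ℤ.- (+ toℕ x) ℤ.+ circSum X f
circSum (◯ ∷ X)  (x ∷ f)  = circSum X f

-- f is a q-coflow of N (condition checked in ℤ/qℤ, i.e. divisibility by q).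
isCoflowᵇ : {n : ℕ} → (q : ℕ) → OM n → Coflow q n → Bool
isCoflowᵇ q N f = all (λ X → ⌊ (+ q) ∣? circSum X f ⌋) N

allVecs : (q n : ℕ) → List (Vec (Fin q) n)
allVecs q zero    = [] ∷ []
allVecs q (suc n) = concatMap (λ x → map (x ∷_) (allVecs q n)) (List.allFin q)

coflows : {n : ℕ} → (q : ℕ) → OM n → List (Coflow q n)
coflows {n} q N = filter (λ f → isCoflowᵇ q N f Data.Bool.≟ true) (allVecs q n)
  where import Data.Bool

-- x ∈ {1,…,⌊q/2⌋} (mod q)        x ∈ f_A^>
isPosᵇ : {q : ℕ} → Fin q → Bool
isPosᵇ {q} x = (1 ≤ᵇ toℕ x) ∧ (toℕ x ≤ᵇ q / 2)

-- −x ∈ {1,…,⌊q/2⌋} (mod q)       x ∈ f_A^<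
isNegᵇ : {q : ℕ} → Fin q → Bool
isNegᵇ {q} x = (1 ≤ᵇ toℕ x) ∧ ((q ∸ toℕ x) ≤ᵇ q / 2)

isZeroᵇ : {q : ℕ} → Fin q → Bool
isZeroᵇ x = toℕ x ℕ.≡ᵇ 0

countᵇ : {A : Set} {n : ℕ} → (A → Bool) → Vec A n → ℕ
countᵇ p []       = 0
countᵇ p (x ∷ xs) = if p x then suc (countᵇ p xs) else countᵇ p xs

#> #< #= #≥ #≤ : {q n : ℕ} → Coflow q n → ℕ
#> f = countᵇ isPosᵇ f
#< f = countᵇ isNegᵇ f
#= f = countᵇ isZeroᵇ f
#≥ f = countᵇ (λ x → isPosᵇ x ∨ isZeroᵇ x) f
#≤ f = countᵇ (λ x → isNegᵇ x ∨ isZeroᵇ x) f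

_^ℚ_ : ℚ → ℕ → ℚ
x ^ℚ zero  = 1ℚ
x ^ℚ suc k = x ℚ.* (x ^ℚ k)

sumℚ : List ℚ → ℚ
sumℚ = List.foldr ℚ._+_ 0ℚ

coflowSum : {n : ℕ} → OM n → ℕ → ℚ → ℚ → ℚ
coflowSum N q y z = sumℚ (map (λ f → (y ^ℚ #> f) ℚ.* (z ^ℚ #< f)) (coflows q N))

coflowSum3 : {n : ℕ} → OM n → ℕ → ℚ → ℚ → ℚ → ℚ
coflowSum3 N q x y z =
  sumℚ (map (λ f → (x ^ℚ #= f) ℚ.* (y ^ℚ #> f) ℚ.* (z ^ℚ #< f)) (coflows q N))

coflowSum≥≤ : {n : ℕ} → OM n → ℕ → ℚ → ℚ → ℚ
coflowSum≥≤ N q y z = sumℚ (map (λ f → (y ^ℚ #≥ f) ℚ.* (z ^ℚ #≤ f)) (coflows q N))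

-- Polynomials in q, y, z with rational coefficients, as lists of
-- monomials  c · q^i y^j z^k.  Two polynomials are equal iff they
-- agree at every point of ℚ³.

Poly3 : Set
Poly3 = List (ℚ × ℕ × ℕ × ℕ)

eval : Poly3 → ℚ → ℚ → ℚ → ℚ
eval P q y z = sumℚ (map (λ { (c , i , j , k) → c ℚ.* (q ^ℚ i) ℚ.* (y ^ℚ j) ℚ.* (z ^ℚ k) }) P)

OddPos : ℕ → Set
OddPos q = Σ[ k ∈ ℕ ] q ≡ suc (2 ℕ.* k)

-- P is the A-polynomial of N: it agrees with the coflow sum at every odd
-- positive q (this characterises P uniquely).
IsAPoly : {n : ℕ} → OM n → Poly3 → Set
IsAPoly N P = (q : ℕ) → OddPos q → (y z : ℚ) →
  eval P ((+ q ℚ./ 1)) y z ≡ coflowSum N q y z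

-- Negation f ↦ -f permutes the q-coflows and exchanges f_A^> with f_A^<, which gives (i).
-- For odd q every residue is exactly one of zero, positive or negative, so
-- |f_A^=| + |f_A^>| + |f_A^<| = |A|; this gives (ii), and (iii) together with (i).
-- If a is a loop, its circuit forces f(a) = 0 and the remaining conditions are those of
-- N∖a.  If a is a coloop, a lies on no circuit, minimality of circuit supports makes the
-- conditions on A ∖ a exactly those of N/a, and f(a) ranges freely over ℤ/qℤ,
-- contributing 1 + (q-1)/2·(y+z).  Coflows of a disjoint union are pairs of coflows.
-- These identities hold at every odd q; polynomials in q that agree at infinitely many
-- points agree everywhere, which turns (i) and (iv)–(vii) into polynomial identities.
module Submission where

open import Defs
open import Data.Nat using (ℕ; suc)
open import Data.Fin using (Fin)
open import Data.Integer using (+_)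
open import Data.Rational using (ℚ; NonZero; _+_; _-_; _*_; _÷_; _/_; ½; 1ℚ)
open import Data.Product using (_×_)
open import Relation.Binary.PropositionalEquality using (_≡_)

open import Data.Bool as Bool using (Bool; true; false; T; not; _∧_; _∨_; if_then_else_)
import Data.Bool.Properties as Boolₚ
open import Data.Bool.ListAction using (any)
open import Data.Empty using (⊥-elim)
open import Data.Fin as Fin using (toℕ)
import Data.Fin.Properties as Finₚ
open import Data.Fin.Permutation using (permutation)
open import Data.Integer as ℤ using (ℤ)
import Data.Integer.Properties as ℤₚ
open import Data.Integer.Divisibility.Signed as ℤ∣ using (_∣_; divides)
import Data.Integer.Solver as ℤSolver
open import Data.List as List using (List; []; _∷_)
import Data.List.Properties as Listₚ
open import Data.List.Membership.Propositional using (_∈_; find)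
import Data.List.Membership.Propositional.Properties as ∈ₚ
open import Data.List.Relation.Unary.All as All using (All; []; _∷_)
import Data.List.Relation.Unary.All.Properties as Allₚ
import Data.List.Relation.Unary.Any as Any
import Data.List.Relation.Unary.Any.Properties as Anyₚ
open import Data.Nat as ℕ using (zero; _<_; s≤s)
import Data.Nat.Properties as ℕₚ
import Data.Nat.Coprimality as Coprimality
import Data.Nat.Divisibility as ℕ∣
import Data.Nat.DivMod as ℕDivMod
import Data.Nat.ListAction as ℕL
import Data.Nat.Solver as ℕSolver
open import Data.Product using (_,_; proj₁; proj₂)
open import Data.Rational as ℚ using (0ℚ; -_; 1/_)
import Data.Rational.Properties as ℚₚ
open import Data.Rational.Solver using (module +-*-Solver)
open import Data.Sum using (inj₁; inj₂)
open import Data.Vec as Vec using (Vec; []; _∷_)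
import Data.Vec.Properties as Vecₚ
open import Function using (_∘_; id; case_of_; _⇔_; mk⇔; Equivalence)
open import Function.Definitions using (Injective)
import Function.Properties.Equivalence as ⇔
open import Data.Product.Function.NonDependent.Propositional using (_×-⇔_)
open import Relation.Binary.PropositionalEquality
  using (refl; sym; trans; cong; cong₂; subst; _≢_; module ≡-Reasoning)
open import Relation.Nullary using (¬_; yes; no)
open import Relation.Nullary.Decidable using (toWitness; fromWitness)

open import Algebra.Bundles using (Ring)
open import Algebra.Properties.CommutativeMonoid.Sum ℚₚ.+-0-commutativeMonoid
  using (sum; sum-syntax; sum-cong-≗; sum-replicate-zero; ∑-comm; ∑-permute)
open import Algebra.Properties.Semiring.Sum (Ring.semiring ℚₚ.+-*-ring) using (*-distribˡ-sum; *-distribʳ-sum)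
open import Algebra.Properties.Group ℚₚ.+-0-group using (x∙y⁻¹≈ε⇒x≈y; x≈y⇒x∙y⁻¹≈ε)
open import Algebra.Properties.CommutativeSemigroup ℕₚ.+-commutativeSemigroup
  using () renaming (x∙yz≈y∙xz to ℕ-x∙yz≈y∙xz)
open import Algebra.Properties.CommutativeSemigroup ℤₚ.+-commutativeSemigroup
  using () renaming (x∙yz≈y∙xz to ℤ-x∙yz≈y∙xz; interchange to ℤ-interchange)

open ≡-Reasoning

^ℚ-+ : ∀ x m n → x ^ℚ (m ℕ.+ n) ≡ (x ^ℚ m) * (x ^ℚ n)
^ℚ-+ x zero    n = sym (ℚₚ.*-identityˡ _)
^ℚ-+ x (suc m) n = trans (cong (x *_) (^ℚ-+ x m n)) (sym (ℚₚ.*-assoc x _ _))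

^ℚ-distrib-* : ∀ x y n → (x * y) ^ℚ n ≡ (x ^ℚ n) * (y ^ℚ n)
^ℚ-distrib-* x y zero    = refl
^ℚ-distrib-* x y (suc n) = trans (cong ((x * y) *_) (^ℚ-distrib-* x y n))
  (solve 4 (λ x y a b → (x :* y) :* (a :* b) := (x :* a) :* (y :* b)) refl x y (x ^ℚ n) (y ^ℚ n))
  where open +-*-Solver

1^ℚ : ∀ n → 1ℚ ^ℚ n ≡ 1ℚ
1^ℚ zero    = refl
1^ℚ (suc n) = trans (ℚₚ.*-identityˡ _) (1^ℚ n)

÷-^ℚ : ∀ y x n .{{_ : NonZero x}} → ((y ÷ x) ^ℚ n) * (x ^ℚ n) ≡ y ^ℚ n
÷-^ℚ y x n = begin
  ((y ÷ x) ^ℚ n) * (x ^ℚ n) ≡⟨ ^ℚ-distrib-* (y ÷ x) x n ⟨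
  (y * 1/ x * x) ^ℚ n       ≡⟨ cong (_^ℚ n) (ℚₚ.*-assoc y (1/ x) x) ⟩
  (y * (1/ x * x)) ^ℚ n     ≡⟨ cong (λ u → (y * u) ^ℚ n) (ℚₚ.*-inverseˡ x) ⟩
  (y * 1ℚ) ^ℚ n             ≡⟨ cong (_^ℚ n) (ℚₚ.*-identityʳ y) ⟩
  y ^ℚ n                    ∎

*-cancelˡ-≡0 : ∀ a b → a ≢ 0ℚ → a * b ≡ 0ℚ → b ≡ 0ℚ
*-cancelˡ-≡0 a b a≢0 ab≡0 = begin
  b              ≡⟨ ℚₚ.*-identityˡ b ⟨
  1ℚ * b         ≡⟨ cong (_* b) (ℚₚ.*-inverseˡ a) ⟨
  1/ a * a * b   ≡⟨ ℚₚ.*-assoc (1/ a) a b ⟩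
  1/ a * (a * b) ≡⟨ cong (1/ a *_) ab≡0 ⟩
  1/ a * 0ℚ      ≡⟨ ℚₚ.*-zeroʳ (1/ a) ⟩
  0ℚ             ∎
  where instance _ = ℚ.≢-nonZero a≢0

^ℚ-+-+ : ∀ x a b c → x ^ℚ (a ℕ.+ b ℕ.+ c) ≡ (x ^ℚ a) * (x ^ℚ b) * (x ^ℚ c)
^ℚ-+-+ x a b c = trans (^ℚ-+ x (a ℕ.+ b) c) (cong (_* (x ^ℚ c)) (^ℚ-+ x a b))

homogenise : ∀ x y z e a b .{{_ : NonZero x}} →
             (x ^ℚ e) * (y ^ℚ a) * (z ^ℚ b) ≡ (x ^ℚ (e ℕ.+ a ℕ.+ b)) * (((y ÷ x) ^ℚ a) * ((z ÷ x) ^ℚ b))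
homogenise x y z e a b = begin
  (x ^ℚ e) * (y ^ℚ a) * (z ^ℚ b)
    ≡⟨ cong₂ (λ u v → (x ^ℚ e) * u * v) (÷-^ℚ y x a) (÷-^ℚ z x b) ⟨
  (x ^ℚ e) * (((y ÷ x) ^ℚ a) * (x ^ℚ a)) * (((z ÷ x) ^ℚ b) * (x ^ℚ b))
    ≡⟨ solve 5 (λ e u a v b → e :* (u :* a) :* (v :* b) := e :* a :* b :* (u :* v)) refl
         (x ^ℚ e) ((y ÷ x) ^ℚ a) (x ^ℚ a) ((z ÷ x) ^ℚ b) (x ^ℚ b) ⟩
  (x ^ℚ e) * (x ^ℚ a) * (x ^ℚ b) * (((y ÷ x) ^ℚ a) * ((z ÷ x) ^ℚ b))
    ≡⟨ cong (_* (((y ÷ x) ^ℚ a) * ((z ÷ x) ^ℚ b))) (^ℚ-+-+ x e a b) ⟨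
  (x ^ℚ (e ℕ.+ a ℕ.+ b)) * (((y ÷ x) ^ℚ a) * ((z ÷ x) ^ℚ b)) ∎
  where open +-*-Solver

dualise : ∀ y z e a b .{{_ : NonZero y}} .{{_ : NonZero z}} →
          (y ^ℚ (a ℕ.+ e)) * (z ^ℚ (b ℕ.+ e)) ≡ ((y * z) ^ℚ (e ℕ.+ a ℕ.+ b)) * (((1ℚ ÷ z) ^ℚ a) * ((1ℚ ÷ y) ^ℚ b))
dualise y z e a b = begin
  (y ^ℚ (a ℕ.+ e)) * (z ^ℚ (b ℕ.+ e))
    ≡⟨ cong₂ _*_ (^ℚ-+ y a e) (^ℚ-+ z b e) ⟩
  ((y ^ℚ a) * (y ^ℚ e)) * ((z ^ℚ b) * (z ^ℚ e))
    ≡⟨ trans (ℚₚ.*-identityʳ _) (ℚₚ.*-identityʳ _) ⟨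
  ((y ^ℚ a) * (y ^ℚ e)) * ((z ^ℚ b) * (z ^ℚ e)) * 1ℚ * 1ℚ
    ≡⟨ cong₂ (λ u v → ((y ^ℚ a) * (y ^ℚ e)) * ((z ^ℚ b) * (z ^ℚ e)) * u * v) 1/zᵃzᵃ≡1 1/yᵇyᵇ≡1 ⟨
  ((y ^ℚ a) * (y ^ℚ e)) * ((z ^ℚ b) * (z ^ℚ e)) * (((1ℚ ÷ z) ^ℚ a) * (z ^ℚ a)) * (((1ℚ ÷ y) ^ℚ b) * (y ^ℚ b))
    ≡⟨ solve 8 (λ ya ye zb ze iza za iyb yb → (ya :* ye) :* (zb :* ze) :* (iza :* za) :* (iyb :* yb)
                                          := (ye :* ze) :* (ya :* za) :* (yb :* zb) :* (iza :* iyb)) refl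
         (y ^ℚ a) (y ^ℚ e) (z ^ℚ b) (z ^ℚ e) ((1ℚ ÷ z) ^ℚ a) (z ^ℚ a) ((1ℚ ÷ y) ^ℚ b) (y ^ℚ b) ⟩
  ((y ^ℚ e) * (z ^ℚ e)) * ((y ^ℚ a) * (z ^ℚ a)) * ((y ^ℚ b) * (z ^ℚ b)) * (((1ℚ ÷ z) ^ℚ a) * ((1ℚ ÷ y) ^ℚ b))
    ≡⟨ cong (_* (((1ℚ ÷ z) ^ℚ a) * ((1ℚ ÷ y) ^ℚ b))) (trans (^ℚ-+-+ (y * z) e a b)
         (cong₂ _*_ (cong₂ _*_ (^ℚ-distrib-* y z e) (^ℚ-distrib-* y z a)) (^ℚ-distrib-* y z b))) ⟨
  ((y * z) ^ℚ (e ℕ.+ a ℕ.+ b)) * (((1ℚ ÷ z) ^ℚ a) * ((1ℚ ÷ y) ^ℚ b)) ∎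
  where
  open +-*-Solver
  1/zᵃzᵃ≡1 : ((1ℚ ÷ z) ^ℚ a) * (z ^ℚ a) ≡ 1ℚ
  1/zᵃzᵃ≡1 = trans (÷-^ℚ 1ℚ z a) (1^ℚ a)
  1/yᵇyᵇ≡1 : ((1ℚ ÷ y) ^ℚ b) * (y ^ℚ b) ≡ 1ℚ
  1/yᵇyᵇ≡1 = trans (÷-^ℚ 1ℚ y b) (1^ℚ b)

ι : ℕ → ℚ
ι n = + n / 1

ι≡mkℚ : ∀ n → ι n ≡ ℚ.mkℚ (+ n) 0 (Coprimality.sym (Coprimality.1-coprimeTo n))
ι≡mkℚ n = ℚₚ.normalize-coprime _

ι-suc : ∀ n → ι (suc n) ≡ 1ℚ + ι n
ι-suc n = begin
  + suc n / 1                                ≡⟨ cong (_/ 1) (trans (ℤₚ.pos-+ 1 n)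
                                                  (solve 1 (λ m → con (+ 1) :+ m := con (+ 1) :* con (+ 1) :+ m :* con (+ 1)) refl (+ n))) ⟩
  (+ 1 ℤ.* + 1 ℤ.+ + n ℤ.* + 1) / 1          ≡⟨⟩
  1ℚ + ℚ.mkℚ (+ n) 0 coprime               ≡⟨ cong (ℚ._+_ 1ℚ) (ι≡mkℚ n) ⟨
  1ℚ + ι n                                   ∎
  where
  open ℤSolver.+-*-Solver
  coprime = Coprimality.sym (Coprimality.1-coprimeTo n)

ι-+ : ∀ m n → ι (m ℕ.+ n) ≡ ι m + ι n
ι-+ zero    n = sym (ℚₚ.+-identityˡ (ι n))
ι-+ (suc m) n = begin
  ι (suc (m ℕ.+ n))  ≡⟨ ι-suc (m ℕ.+ n) ⟩
  1ℚ + ι (m ℕ.+ n)   ≡⟨ cong (ℚ._+_ 1ℚ) (ι-+ m n) ⟩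
  1ℚ + (ι m + ι n)   ≡⟨ ℚₚ.+-assoc 1ℚ (ι m) (ι n) ⟨
  (1ℚ + ι m) + ι n   ≡⟨ cong (_+ ι n) (ι-suc m) ⟨
  ι (suc m) + ι n    ∎

ι-injective : Injective _≡_ _≡_ ι
ι-injective {m} {n} ιm≡ιn = ℤₚ.+-injective (begin
  + m               ≡⟨ cong ℚ.↥_ (ι≡mkℚ m) ⟨
  ℚ.↥ ι m           ≡⟨ cong ℚ.↥_ ιm≡ιn ⟩
  ℚ.↥ ι n           ≡⟨ cong ℚ.↥_ (ι≡mkℚ n) ⟩
  + n               ∎)

∑ᵛ : (q n : ℕ) → (Vec (Fin q) n → ℚ) → ℚ
∑ᵛ q zero    g = g []
∑ᵛ q (suc n) g = ∑[ x < q ] ∑ᵛ q n (λ f → g (x ∷ f))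

∑ᵛ-cong : ∀ q n {g h : Vec (Fin q) n → ℚ} → (∀ f → g f ≡ h f) → ∑ᵛ q n g ≡ ∑ᵛ q n h
∑ᵛ-cong q zero    g≗h = g≗h []
∑ᵛ-cong q (suc n) g≗h = sum-cong-≗ (λ (x : Fin q) → ∑ᵛ-cong q n (λ f → g≗h (x ∷ f)))

*-distribˡ-∑ᵛ : ∀ q n c (g : Vec (Fin q) n → ℚ) → c * ∑ᵛ q n g ≡ ∑ᵛ q n (λ f → c * g f)
*-distribˡ-∑ᵛ q zero    c g = refl
*-distribˡ-∑ᵛ q (suc n) c g =
  trans (*-distribˡ-sum c (λ x → ∑ᵛ q n (λ f → g (x ∷ f))))
        (sum-cong-≗ (λ (x : Fin q) → *-distribˡ-∑ᵛ q n c (λ f → g (x ∷ f))))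

∑ᵛ-comm-sum : ∀ q n {k} (h : Vec (Fin q) n → Fin k → ℚ) →
              ∑ᵛ q n (λ f → sum (h f)) ≡ ∑[ i < k ] ∑ᵛ q n (λ f → h f i)
∑ᵛ-comm-sum q zero    h = refl
∑ᵛ-comm-sum q (suc n) h =
  trans (sum-cong-≗ (λ (x : Fin q) → ∑ᵛ-comm-sum q n (λ f → h (x ∷ f)))) (∑-comm (λ x i → ∑ᵛ q n (λ f → h (x ∷ f) i)))

∑ᵛ-insertAt : ∀ q m (a : Fin (suc m)) (g : Vec (Fin q) (suc m) → ℚ) →
              ∑ᵛ q (suc m) g ≡ ∑ᵛ q m (λ f → ∑[ x < q ] g (Vec.insertAt f a x))
∑ᵛ-insertAt q m       Fin.zero    g = sym (∑ᵛ-comm-sum q m (λ f x → g (x ∷ f)))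
∑ᵛ-insertAt q (suc m) (Fin.suc a) g = sum-cong-≗ (λ (y : Fin q) → ∑ᵛ-insertAt q m a (λ f → g (y ∷ f)))

∑ᵛ-++ : ∀ q n₁ n₂ (g : Vec (Fin q) (n₁ ℕ.+ n₂) → ℚ) →
        ∑ᵛ q (n₁ ℕ.+ n₂) g ≡ ∑ᵛ q n₁ (λ f → ∑ᵛ q n₂ (λ h → g (f Vec.++ h)))
∑ᵛ-++ q zero     n₂ g = refl
∑ᵛ-++ q (suc n₁) n₂ g = sum-cong-≗ (λ (x : Fin q) → ∑ᵛ-++ q n₁ n₂ _)

∑ᵛ-* : ∀ q n₁ n₂ (u : Vec (Fin q) n₁ → ℚ) (v : Vec (Fin q) n₂ → ℚ) →
       ∑ᵛ q n₁ (λ f → ∑ᵛ q n₂ (λ h → u f * v h)) ≡ ∑ᵛ q n₁ u * ∑ᵛ q n₂ v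
∑ᵛ-* q n₁ n₂ u v = begin
  ∑ᵛ q n₁ (λ f → ∑ᵛ q n₂ (λ h → u f * v h)) ≡⟨ ∑ᵛ-cong q n₁ (λ f → *-distribˡ-∑ᵛ q n₂ (u f) v) ⟨
  ∑ᵛ q n₁ (λ f → u f * ∑ᵛ q n₂ v)           ≡⟨ ∑ᵛ-cong q n₁ (λ f → ℚₚ.*-comm (u f) _) ⟩
  ∑ᵛ q n₁ (λ f → ∑ᵛ q n₂ v * u f)           ≡⟨ *-distribˡ-∑ᵛ q n₁ (∑ᵛ q n₂ v) u ⟨
  ∑ᵛ q n₂ v * ∑ᵛ q n₁ u                     ≡⟨ ℚₚ.*-comm (∑ᵛ q n₂ v) _ ⟩
  ∑ᵛ q n₁ u * ∑ᵛ q n₂ v                     ∎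

∑ᵛ-map : ∀ q n (σ : Fin q → Fin q) → (∀ (g : Fin q → ℚ) → sum (g ∘ σ) ≡ sum g) →
         (g : Vec (Fin q) n → ℚ) → ∑ᵛ q n (g ∘ Vec.map σ) ≡ ∑ᵛ q n g
∑ᵛ-map q zero    σ σ-inv g = refl
∑ᵛ-map q (suc n) σ σ-inv g =
  trans (sum-cong-≗ (λ (x : Fin q) → ∑ᵛ-map q n σ σ-inv (λ f → g (σ x ∷ f))))
        (σ-inv (λ x → ∑ᵛ q n (λ f → g (x ∷ f))))

sumℚ-++ : ∀ xs ys → sumℚ (xs List.++ ys) ≡ sumℚ xs + sumℚ ys
sumℚ-++ []       ys = sym (ℚₚ.+-identityˡ _)
sumℚ-++ (x ∷ xs) ys = trans (cong (ℚ._+_ x) (sumℚ-++ xs ys)) (sym (ℚₚ.+-assoc x _ _))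

sumℚ-tabulate : ∀ k (g : Fin k → ℚ) → sumℚ (List.tabulate g) ≡ sum g
sumℚ-tabulate zero    g = refl
sumℚ-tabulate (suc k) g = cong (ℚ._+_ (g Fin.zero)) (sumℚ-tabulate k (g ∘ Fin.suc))

sumℚ-map-allFin : ∀ k (g : Fin k → ℚ) → sumℚ (List.map g (List.allFin k)) ≡ sum g
sumℚ-map-allFin k g = trans (cong sumℚ (Listₚ.map-tabulate id g)) (sumℚ-tabulate k g)

sumℚ-map-concatMap : ∀ {A B : Set} (g : B → ℚ) (h : A → List B) xs →
  sumℚ (List.map g (List.concatMap h xs)) ≡ sumℚ (List.map (λ x → sumℚ (List.map g (h x))) xs)
sumℚ-map-concatMap g h []       = refl
sumℚ-map-concatMap g h (x ∷ xs) = begin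
  sumℚ (List.map g (h x List.++ List.concatMap h xs))
    ≡⟨ cong sumℚ (Listₚ.map-++ g (h x) (List.concatMap h xs)) ⟩
  sumℚ (List.map g (h x) List.++ List.map g (List.concatMap h xs))
    ≡⟨ sumℚ-++ (List.map g (h x)) (List.map g (List.concatMap h xs)) ⟩
  sumℚ (List.map g (h x)) + sumℚ (List.map g (List.concatMap h xs))
    ≡⟨ cong (ℚ._+_ (sumℚ (List.map g (h x)))) (sumℚ-map-concatMap g h xs) ⟩
  sumℚ (List.map g (h x)) + sumℚ (List.map (λ x → sumℚ (List.map g (h x))) xs) ∎

sumℚ-map-allVecs : ∀ q n (g : Vec (Fin q) n → ℚ) → sumℚ (List.map g (allVecs q n)) ≡ ∑ᵛ q n g
sumℚ-map-allVecs q zero    g = ℚₚ.+-identityʳ (g [])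
sumℚ-map-allVecs q (suc n) g = begin
  sumℚ (List.map g (List.concatMap (λ x → List.map (x ∷_) (allVecs q n)) (List.allFin q)))
    ≡⟨ sumℚ-map-concatMap g (λ x → List.map (x ∷_) (allVecs q n)) (List.allFin q) ⟩
  sumℚ (List.map (λ x → sumℚ (List.map g (List.map (x ∷_) (allVecs q n)))) (List.allFin q))
    ≡⟨ sumℚ-map-allFin q _ ⟩
  ∑[ x < q ] sumℚ (List.map g (List.map (x ∷_) (allVecs q n)))
    ≡⟨ sum-cong-≗ (λ (x : Fin q) → trans (cong sumℚ (sym (Listₚ.map-∘ (allVecs q n))))
                                          (sumℚ-map-allVecs q n (λ f → g (x ∷ f)))) ⟩
  ∑ᵛ q (suc n) g ∎

when : Bool → ℚ → ℚ
when b v = if b then v else 0ℚ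

sumℚ-map-filter : ∀ {A : Set} (b : A → Bool) (g : A → ℚ) xs →
  sumℚ (List.map g (List.filter (λ x → b x Bool.≟ true) xs)) ≡ sumℚ (List.map (λ x → when (b x) (g x)) xs)
sumℚ-map-filter b g []       = refl
sumℚ-map-filter b g (x ∷ xs) with b x
... | true  = cong (ℚ._+_ (g x)) (sumℚ-map-filter b g xs)
... | false = trans (sumℚ-map-filter b g xs) (sym (ℚₚ.+-identityˡ _))

sumℚ-coflows : ∀ {n} q (N : OM n) (w : Coflow q n → ℚ) →
  sumℚ (List.map w (coflows q N)) ≡ ∑ᵛ q n (λ f → when (isCoflowᵇ q N f) (w f))
sumℚ-coflows {n} q N w = trans (sumℚ-map-filter (isCoflowᵇ q N) w (allVecs q n)) (sumℚ-map-allVecs q n _)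

horner : ∀ {n} → Vec ℚ n → ℚ → ℚ
horner []      x = 0ℚ
horner (c ∷ p) x = c + x * horner p x

-- Synthetic division by x - r.
quotient : ∀ {n} → Vec ℚ (suc n) → ℚ → Vec ℚ n
quotient (c ∷ [])        r = []
quotient (c ∷ p@(_ ∷ _)) r = horner p r ∷ quotient p r

horner-factor : ∀ {n} (p : Vec ℚ (suc n)) r x →
                horner p x ≡ (x - r) * horner (quotient p r) x + horner p r
horner-factor (c ∷ [])        r x =
  solve 3 (λ c x r → c :+ x :* con 0ℚ := (x :- r) :* con 0ℚ :+ (c :+ r :* con 0ℚ)) refl c x r
  where open +-*-Solver
horner-factor (c ∷ p@(_ ∷ _)) r x = begin
  c + x * horner p x
    ≡⟨ cong (λ u → c + x * u) (horner-factor p r x) ⟩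
  c + x * ((x - r) * horner (quotient p r) x + horner p r)
    ≡⟨ solve 5 (λ c x r d e → c :+ x :* ((x :- r) :* d :+ e) := (x :- r) :* (e :+ x :* d) :+ (c :+ r :* e))
             refl c x r (horner (quotient p r) x) (horner p r) ⟩
  (x - r) * (horner p r + x * horner (quotient p r) x) + (c + r * horner p r) ∎
  where open +-*-Solver

-- Divide out x - s 0 and recurse on the remaining points of the sequence.
horner-≡0 : ∀ {n} (p : Vec ℚ n) (s : ℕ → ℚ) → Injective _≡_ _≡_ s →
            (∀ m → horner p (s m) ≡ 0ℚ) → ∀ x → horner p x ≡ 0ℚ
horner-≡0 []          s s-inj p∘s≡0 x = refl
horner-≡0 p@(_ ∷ _)   s s-inj p∘s≡0 x = begin
  horner p x                                   ≡⟨ horner-factor p (s 0) x ⟩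
  (x - s 0) * horner d x + horner p (s 0)      ≡⟨ cong₂ (λ u v → (x - s 0) * u + v) (d≡0 x) (p∘s≡0 0) ⟩
  (x - s 0) * 0ℚ + 0ℚ                          ≡⟨ solve 2 (λ x r → (x :- r) :* con 0ℚ :+ con 0ℚ := con 0ℚ) refl x (s 0) ⟩
  0ℚ                                           ∎
  where
  open +-*-Solver
  d = quotient p (s 0)
  d∘s≡0 : ∀ m → horner d (s (suc m)) ≡ 0ℚ
  d∘s≡0 m = *-cancelˡ-≡0 (s (suc m) - s 0) _
    (λ eq → ℕₚ.1+n≢0 (s-inj (x∙y⁻¹≈ε⇒x≈y (s (suc m)) (s 0) eq)))
    (begin
      (s (suc m) - s 0) * horner d (s (suc m))                        ≡⟨ ℚₚ.+-identityʳ _ ⟨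
      (s (suc m) - s 0) * horner d (s (suc m)) + 0ℚ
        ≡⟨ cong (ℚ._+_ ((s (suc m) - s 0) * horner d (s (suc m)))) (p∘s≡0 0) ⟨
      (s (suc m) - s 0) * horner d (s (suc m)) + horner p (s 0)       ≡⟨ horner-factor p (s 0) (s (suc m)) ⟨
      horner p (s (suc m))                                            ≡⟨ p∘s≡0 (suc m) ⟩
      0ℚ                                                              ∎)
  d≡0 = horner-≡0 d (s ∘ suc) (ℕₚ.suc-injective ∘ s-inj) d∘s≡0

horner-zipWith-- : ∀ {n} (u v : Vec ℚ n) x → horner (Vec.zipWith _-_ u v) x ≡ horner u x - horner v x
horner-zipWith-- []      []      x = refl
horner-zipWith-- (a ∷ u) (b ∷ v) x = trans (cong (λ w → a - b + x * w) (horner-zipWith-- u v x))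
  (solve 5 (λ a b x u v → a :- b :+ x :* (u :- v) := (a :+ x :* u) :- (b :+ x :* v)) refl a b x (horner u x) (horner v x))
  where open +-*-Solver

horner-unique : ∀ {n} (u v : Vec ℚ n) (s : ℕ → ℚ) → Injective _≡_ _≡_ s →
                (∀ m → horner u (s m) ≡ horner v (s m)) → ∀ x → horner u x ≡ horner v x
horner-unique u v s s-inj u∘s≡v∘s x =
  x∙y⁻¹≈ε⇒x≈y _ _ (trans (sym (horner-zipWith-- u v x)) (horner-≡0 (Vec.zipWith _-_ u v) s s-inj
    (λ m → trans (horner-zipWith-- u v (s m)) (x≈y⇒x∙y⁻¹≈ε (u∘s≡v∘s m))) x))

-- d xⁱ as a coefficient vector of length n (zero when n ≤ i).
monomial : ℚ → ℕ → (n : ℕ) → Vec ℚ n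
monomial d i       zero    = []
monomial d zero    (suc n) = d ∷ Vec.replicate n 0ℚ
monomial d (suc i) (suc n) = 0ℚ ∷ monomial d i n

horner-replicate-0 : ∀ n x → horner (Vec.replicate n 0ℚ) x ≡ 0ℚ
horner-replicate-0 zero    x = refl
horner-replicate-0 (suc n) x = trans (cong (λ u → 0ℚ + x * u) (horner-replicate-0 n x))
  (solve 1 (λ x → con 0ℚ :+ x :* con 0ℚ := con 0ℚ) refl x)
  where open +-*-Solver

horner-monomial : ∀ d i n x → i < n → horner (monomial d i n) x ≡ d * (x ^ℚ i)
horner-monomial d zero    (suc n) x _ = trans (cong (λ u → d + x * u) (horner-replicate-0 n x))
  (solve 2 (λ d x → d :+ x :* con 0ℚ := d :* con 1ℚ) refl d x)
  where open +-*-Solver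
horner-monomial d (suc i) (suc n) x (s≤s i<n) = trans (cong (λ u → 0ℚ + x * u) (horner-monomial d i n x i<n))
  (solve 3 (λ d x a → con 0ℚ :+ x :* (d :* a) := d :* (x :* a)) refl d x (x ^ℚ i))
  where open +-*-Solver

horner-zipWith-+ : ∀ {n} (u v : Vec ℚ n) x → horner (Vec.zipWith _+_ u v) x ≡ horner u x + horner v x
horner-zipWith-+ []      []      x = sym (ℚₚ.+-identityˡ 0ℚ)
horner-zipWith-+ (a ∷ u) (b ∷ v) x = trans (cong (λ w → a + b + x * w) (horner-zipWith-+ u v x))
  (solve 5 (λ a b x u v → a :+ b :+ x :* (u :+ v) := (a :+ x :* u) :+ (b :+ x :* v)) refl a b x (horner u x) (horner v x))
  where open +-*-Solver

qDegree : ℚ × ℕ × ℕ × ℕ → ℕ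
qDegree (c , i , j , k) = i

qDegree<_ : ℕ → Poly3 → Set
qDegree< n = All (λ m → qDegree m < n)

qDegree-bound : ∀ P → (qDegree< suc (ℕL.sum (List.map qDegree P))) P
qDegree-bound []      = []
qDegree-bound (m ∷ P) = s≤s (ℕₚ.m≤m+n (qDegree m) _)
  ∷ All.map (λ i<n → ℕₚ.<-≤-trans i<n (s≤s (ℕₚ.m≤n+m _ (qDegree m)))) (qDegree-bound P)

qCoefficients : ℚ → ℚ → Poly3 → (n : ℕ) → Vec ℚ n
qCoefficients y z []                    n = Vec.replicate n 0ℚ
qCoefficients y z ((c , i , j , k) ∷ P) n =
  Vec.zipWith _+_ (monomial (c * (y ^ℚ j) * (z ^ℚ k)) i n) (qCoefficients y z P n)

horner-qCoefficients : ∀ y z P n → (qDegree< n) P → ∀ x → horner (qCoefficients y z P n) x ≡ eval P x y z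
horner-qCoefficients y z []                    n []           x = horner-replicate-0 n x
horner-qCoefficients y z ((c , i , j , k) ∷ P) n (i<n ∷ P<n) x = begin
  horner (Vec.zipWith _+_ (monomial d i n) (qCoefficients y z P n)) x
    ≡⟨ horner-zipWith-+ (monomial d i n) _ x ⟩
  horner (monomial d i n) x + horner (qCoefficients y z P n) x
    ≡⟨ cong₂ _+_ (horner-monomial d i n x i<n) (horner-qCoefficients y z P n P<n x) ⟩
  d * (x ^ℚ i) + eval P x y z
    ≡⟨ cong (_+ eval P x y z) (solve 4 (λ c a b e → c :* a :* b :* e := c :* e :* a :* b) refl c (y ^ℚ j) (z ^ℚ k) (x ^ℚ i)) ⟩
  eval ((c , i , j , k) ∷ P) x y z ∎
  where
  open +-*-Solver
  d = c * (y ^ℚ j) * (z ^ℚ k)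

eval-unique : ∀ P Q → (∀ q → OddPos q → ∀ y z → eval P (ι q) y z ≡ eval Q (ι q) y z) →
              ∀ q y z → eval P q y z ≡ eval Q q y z
eval-unique P Q P≡Q q y z = begin
  eval P q y z                ≡⟨ horner-qCoefficients y z P n P<n q ⟨
  horner (coefficients P) q   ≡⟨ horner-unique (coefficients P) (coefficients Q) (ι ∘ odd) odd-injective
                                   (λ t → trans (horner-qCoefficients y z P n P<n _)
                                          (trans (P≡Q (odd t) (t , refl) y z) (sym (horner-qCoefficients y z Q n Q<n _)))) q ⟩
  horner (coefficients Q) q   ≡⟨ horner-qCoefficients y z Q n Q<n q ⟩
  eval Q q y z                ∎
  where
  n = suc (ℕL.sum (List.map qDegree (P List.++ Q)))
  P<n = Allₚ.++⁻ˡ P (qDegree-bound (P List.++ Q))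
  Q<n = Allₚ.++⁻ʳ P (qDegree-bound (P List.++ Q))
  coefficients = λ R → qCoefficients y z R n
  odd : ℕ → ℕ
  odd t = suc (2 ℕ.* t)
  odd-injective : Injective _≡_ _≡_ (ι ∘ odd)
  odd-injective = ℕₚ.*-cancelˡ-≡ _ _ 2 ∘ ℕₚ.suc-injective ∘ ι-injective

swapYZ : Poly3 → Poly3
swapYZ = List.map (λ (c , i , j , k) → (c , i , k , j))

eval-swapYZ : ∀ P q y z → eval (swapYZ P) q y z ≡ eval P q z y
eval-swapYZ []                    q y z = refl
eval-swapYZ ((c , i , j , k) ∷ P) q y z = cong₂ _+_
  (solve 4 (λ c a b e → c :* a :* b :* e := c :* a :* e :* b) refl c (q ^ℚ i) (y ^ℚ k) (z ^ℚ j))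
  (eval-swapYZ P q y z)
  where open +-*-Solver

infixl 7 _*ᴾ_

_*ᴹ_ : ℚ × ℕ × ℕ × ℕ → ℚ × ℕ × ℕ × ℕ → ℚ × ℕ × ℕ × ℕ
(c , i , j , k) *ᴹ (d , i′ , j′ , k′) = (c * d , i ℕ.+ i′ , j ℕ.+ j′ , k ℕ.+ k′)

_*ᴾ_ : Poly3 → Poly3 → Poly3
P *ᴾ Q = List.concatMap (λ m → List.map (m *ᴹ_) Q) P

evalᴹ : ℚ × ℕ × ℕ × ℕ → ℚ → ℚ → ℚ → ℚ
evalᴹ m = eval (m ∷ [])

evalᴹ-*ᴹ : ∀ m m′ q y z → evalᴹ (m *ᴹ m′) q y z ≡ evalᴹ m q y z * evalᴹ m′ q y z
evalᴹ-*ᴹ (c , i , j , k) (d , i′ , j′ , k′) q y z = begin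
  c * d * (q ^ℚ (i ℕ.+ i′)) * (y ^ℚ (j ℕ.+ j′)) * (z ^ℚ (k ℕ.+ k′)) + 0ℚ
    ≡⟨ cong₂ (λ u v → c * d * u * v * (z ^ℚ (k ℕ.+ k′)) + 0ℚ) (^ℚ-+ q i i′) (^ℚ-+ y j j′) ⟩
  c * d * ((q ^ℚ i) * (q ^ℚ i′)) * ((y ^ℚ j) * (y ^ℚ j′)) * (z ^ℚ (k ℕ.+ k′)) + 0ℚ
    ≡⟨ cong (λ u → c * d * ((q ^ℚ i) * (q ^ℚ i′)) * ((y ^ℚ j) * (y ^ℚ j′)) * u + 0ℚ) (^ℚ-+ z k k′) ⟩
  c * d * ((q ^ℚ i) * (q ^ℚ i′)) * ((y ^ℚ j) * (y ^ℚ j′)) * ((z ^ℚ k) * (z ^ℚ k′)) + 0ℚ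
    ≡⟨ solve 8 (λ c d a a′ b b′ e e′ → c :* d :* (a :* a′) :* (b :* b′) :* (e :* e′) :+ con 0ℚ
                                     := (c :* a :* b :* e :+ con 0ℚ) :* (d :* a′ :* b′ :* e′ :+ con 0ℚ))
         refl c d (q ^ℚ i) (q ^ℚ i′) (y ^ℚ j) (y ^ℚ j′) (z ^ℚ k) (z ^ℚ k′) ⟩
  evalᴹ (c , i , j , k) q y z * evalᴹ (d , i′ , j′ , k′) q y z ∎
  where open +-*-Solver

eval-∷ : ∀ m P q y z → eval (m ∷ P) q y z ≡ evalᴹ m q y z + eval P q y z
eval-∷ (c , i , j , k) P q y z = cong (_+ eval P q y z) (sym (ℚₚ.+-identityʳ (c * (q ^ℚ i) * (y ^ℚ j) * (z ^ℚ k))))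

eval-++ : ∀ P Q q y z → eval (P List.++ Q) q y z ≡ eval P q y z + eval Q q y z
eval-++ []      Q q y z = sym (ℚₚ.+-identityˡ _)
eval-++ (m ∷ P) Q q y z = begin
  eval (m ∷ P List.++ Q) q y z                     ≡⟨ eval-∷ m (P List.++ Q) q y z ⟩
  evalᴹ m q y z + eval (P List.++ Q) q y z         ≡⟨ cong (ℚ._+_ (evalᴹ m q y z)) (eval-++ P Q q y z) ⟩
  evalᴹ m q y z + (eval P q y z + eval Q q y z)    ≡⟨ ℚₚ.+-assoc (evalᴹ m q y z) _ _ ⟨
  (evalᴹ m q y z + eval P q y z) + eval Q q y z    ≡⟨ cong (_+ eval Q q y z) (eval-∷ m P q y z) ⟨
  eval (m ∷ P) q y z + eval Q q y z                ∎

eval-*ᴾ : ∀ P Q q y z → eval (P *ᴾ Q) q y z ≡ eval P q y z * eval Q q y z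
eval-*ᴾ []      Q q y z = sym (ℚₚ.*-zeroˡ (eval Q q y z))
eval-*ᴾ (m ∷ P) Q q y z = begin
  eval (List.map (m *ᴹ_) Q List.++ P *ᴾ Q) q y z
    ≡⟨ eval-++ (List.map (m *ᴹ_) Q) (P *ᴾ Q) q y z ⟩
  eval (List.map (m *ᴹ_) Q) q y z + eval (P *ᴾ Q) q y z
    ≡⟨ cong₂ _+_ (eval-map-*ᴹ Q) (eval-*ᴾ P Q q y z) ⟩
  evalᴹ m q y z * eval Q q y z + eval P q y z * eval Q q y z
    ≡⟨ ℚₚ.*-distribʳ-+ (eval Q q y z) (evalᴹ m q y z) (eval P q y z) ⟨
  (evalᴹ m q y z + eval P q y z) * eval Q q y z
    ≡⟨ cong (_* eval Q q y z) (eval-∷ m P q y z) ⟨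
  eval (m ∷ P) q y z * eval Q q y z ∎
  where
  eval-map-*ᴹ : ∀ Q → eval (List.map (m *ᴹ_) Q) q y z ≡ evalᴹ m q y z * eval Q q y z
  eval-map-*ᴹ []       = sym (ℚₚ.*-zeroʳ (evalᴹ m q y z))
  eval-map-*ᴹ (m′ ∷ Q) = begin
    eval (m *ᴹ m′ ∷ List.map (m *ᴹ_) Q) q y z
      ≡⟨ eval-∷ (m *ᴹ m′) (List.map (m *ᴹ_) Q) q y z ⟩
    evalᴹ (m *ᴹ m′) q y z + eval (List.map (m *ᴹ_) Q) q y z
      ≡⟨ cong₂ _+_ (evalᴹ-*ᴹ m m′ q y z) (eval-map-*ᴹ Q) ⟩
    evalᴹ m q y z * evalᴹ m′ q y z + evalᴹ m q y z * eval Q q y z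
      ≡⟨ ℚₚ.*-distribˡ-+ (evalᴹ m q y z) (evalᴹ m′ q y z) (eval Q q y z) ⟨
    evalᴹ m q y z * (evalᴹ m′ q y z + eval Q q y z)
      ≡⟨ cong (evalᴹ m q y z *_) (eval-∷ m′ Q q y z) ⟨
    evalᴹ m q y z * eval (m′ ∷ Q) q y z ∎

1ᴾ : Poly3
1ᴾ = (1ℚ , 0 , 0 , 0) ∷ []

coloopFactor : Poly3
coloopFactor = (1ℚ , 0 , 0 , 0) ∷ (½ , 1 , 1 , 0) ∷ (½ , 1 , 0 , 1) ∷ (- ½ , 0 , 1 , 0) ∷ (- ½ , 0 , 0 , 1) ∷ []

eval-coloopFactor : ∀ q y z → eval coloopFactor q y z ≡ 1ℚ + ((q - 1ℚ) * ½) * (y + z)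
eval-coloopFactor q y z = solve 4 (λ q y z h →
     con 1ℚ :* con 1ℚ :* con 1ℚ :* con 1ℚ :+ (h :* (q :* con 1ℚ) :* (y :* con 1ℚ) :* con 1ℚ
       :+ (h :* (q :* con 1ℚ) :* con 1ℚ :* (z :* con 1ℚ) :+ ((:- h) :* con 1ℚ :* (y :* con 1ℚ) :* con 1ℚ
       :+ ((:- h) :* con 1ℚ :* con 1ℚ :* (z :* con 1ℚ) :+ con 0ℚ))))
     := con 1ℚ :+ ((q :- con 1ℚ) :* h) :* (y :+ z)) refl q y z ½
  where open +-*-Solver

T-injective : ∀ {a b} → (T a ⇔ T b) → a ≡ b
T-injective {false} {false} _   = refl
T-injective {false} {true}  a⇔b = ⊥-elim (Equivalence.from a⇔b _)
T-injective {true}  {false} a⇔b = ⊥-elim (Equivalence.to a⇔b _)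
T-injective {true}  {true}  _   = refl

T⇒≡true : ∀ {b} → T b → b ≡ true
T⇒≡true = Equivalence.to Boolₚ.T-≡

¬T⇒≡false : ∀ {b} → ¬ T b → b ≡ false
¬T⇒≡false {false} _  = refl
¬T⇒≡false {true}  ¬t = ⊥-elim (¬t _)

T-not⇒¬T : ∀ {b} → T (not b) → ¬ T b
T-not⇒¬T {false} _ ()

boolToℕ : Bool → ℕ
boolToℕ b = if b then 1 else 0

countᵇ-∷ : ∀ {A : Set} {n} (p : A → Bool) x (xs : Vec A n) → countᵇ p (x ∷ xs) ≡ boolToℕ (p x) ℕ.+ countᵇ p xs
countᵇ-∷ p x xs with p x
... | true  = refl
... | false = refl

countᵇ-cong : ∀ {A : Set} {n} {p r : A → Bool} → (∀ x → p x ≡ r x) → (xs : Vec A n) → countᵇ p xs ≡ countᵇ r xs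
countᵇ-cong             p≗r []       = refl
countᵇ-cong {p = p} {r} p≗r (x ∷ xs) = begin
  countᵇ p (x ∷ xs)                 ≡⟨ countᵇ-∷ p x xs ⟩
  boolToℕ (p x) ℕ.+ countᵇ p xs     ≡⟨ cong₂ (λ b c → boolToℕ b ℕ.+ c) (p≗r x) (countᵇ-cong p≗r xs) ⟩
  boolToℕ (r x) ℕ.+ countᵇ r xs     ≡⟨ countᵇ-∷ r x xs ⟨
  countᵇ r (x ∷ xs)                 ∎

countᵇ-map : ∀ {A B : Set} {n} (p : B → Bool) (h : A → B) (xs : Vec A n) →
             countᵇ p (Vec.map h xs) ≡ countᵇ (p ∘ h) xs
countᵇ-map p h []       = refl
countᵇ-map p h (x ∷ xs) with p (h x)
... | true  = cong suc (countᵇ-map p h xs)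
... | false = countᵇ-map p h xs

countᵇ-++ : ∀ {A : Set} {m n} (p : A → Bool) (xs : Vec A m) (ys : Vec A n) →
            countᵇ p (xs Vec.++ ys) ≡ countᵇ p xs ℕ.+ countᵇ p ys
countᵇ-++ p []       ys = refl
countᵇ-++ p (x ∷ xs) ys with p x
... | true  = cong suc (countᵇ-++ p xs ys)
... | false = countᵇ-++ p xs ys

countᵇ-insertAt : ∀ {A : Set} {n} (p : A → Bool) (xs : Vec A n) a x →
                  countᵇ p (Vec.insertAt xs a x) ≡ countᵇ p (x ∷ xs)
countᵇ-insertAt p xs       Fin.zero    x = refl
countᵇ-insertAt p (y ∷ xs) (Fin.suc a) x = begin
  countᵇ p (y ∷ Vec.insertAt xs a x)                 ≡⟨ countᵇ-∷ p y (Vec.insertAt xs a x) ⟩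
  boolToℕ (p y) ℕ.+ countᵇ p (Vec.insertAt xs a x)   ≡⟨ cong (boolToℕ (p y) ℕ.+_) (countᵇ-insertAt p xs a x) ⟩
  boolToℕ (p y) ℕ.+ countᵇ p (x ∷ xs)                ≡⟨ cong (boolToℕ (p y) ℕ.+_) (countᵇ-∷ p x xs) ⟩
  boolToℕ (p y) ℕ.+ (boolToℕ (p x) ℕ.+ countᵇ p xs)  ≡⟨ ℕ-x∙yz≈y∙xz (boolToℕ (p y)) (boolToℕ (p x)) (countᵇ p xs) ⟩
  boolToℕ (p x) ℕ.+ (boolToℕ (p y) ℕ.+ countᵇ p xs)  ≡⟨ cong (boolToℕ (p x) ℕ.+_) (countᵇ-∷ p y xs) ⟨
  boolToℕ (p x) ℕ.+ countᵇ p (y ∷ xs)                ≡⟨ countᵇ-∷ p x (y ∷ xs) ⟨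
  countᵇ p (x ∷ y ∷ xs)                              ∎

countᵇ-∨ : ∀ {A : Set} {n} (p r : A → Bool) → (∀ x → p x ∧ r x ≡ false) → (xs : Vec A n) →
           countᵇ (λ x → p x ∨ r x) xs ≡ countᵇ p xs ℕ.+ countᵇ r xs
countᵇ-∨ p r disjoint []       = refl
countᵇ-∨ p r disjoint (x ∷ xs) with p x | r x | disjoint x
... | true  | true  | ()
... | true  | false | _ = cong suc (countᵇ-∨ p r disjoint xs)
... | false | true  | _ = trans (cong suc (countᵇ-∨ p r disjoint xs)) (sym (ℕₚ.+-suc _ _))
... | false | false | _ = countᵇ-∨ p r disjoint xs

IsCoflow : ∀ {n} (q : ℕ) → OM n → Coflow q n → Set
IsCoflow q N f = ∀ {X} → X ∈ N → + q ∣ circSum X f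

isCoflowᵇ⇔IsCoflow : ∀ {n} q (N : OM n) f → T (isCoflowᵇ q N f) ⇔ IsCoflow q N f
isCoflowᵇ⇔IsCoflow q N f = mk⇔
  (λ t {X} X∈N → toWitness (All.lookup (Allₚ.all⁺ _ N t) X∈N))
  (λ f-coflow → Allₚ.all⁻ _ (All.tabulate (λ X∈N → fromWitness (f-coflow X∈N))))

isCoflowᵇ-cong : ∀ {m n} q {N : OM m} {N′ : OM n} {f g} →
                 (IsCoflow q N f ⇔ IsCoflow q N′ g) → isCoflowᵇ q N f ≡ isCoflowᵇ q N′ g
isCoflowᵇ-cong q {N} {N′} {f} {g} f⇔g =
  T-injective (⇔.trans (isCoflowᵇ⇔IsCoflow q N f) (⇔.trans f⇔g (⇔.sym (isCoflowᵇ⇔IsCoflow q N′ g))))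

signed : ∀ {q} → Sign → Fin q → ℤ
signed ⊕ x = + toℕ x
signed ⊖ x = ℤ.- (+ toℕ x)
signed ◯ x = + 0

circSum-∷ : ∀ {q n} s (x : Fin q) (X : SignVec n) f → circSum (s ∷ X) (x ∷ f) ≡ signed s x ℤ.+ circSum X f
circSum-∷ ⊕ x X f = refl
circSum-∷ ⊖ x X f = refl
circSum-∷ ◯ x X f = sym (ℤₚ.+-identityˡ _)

circSum-insertAt : ∀ {q m} (X : SignVec m) (f : Coflow q m) a s x →
                   circSum (Vec.insertAt X a s) (Vec.insertAt f a x) ≡ signed s x ℤ.+ circSum X f
circSum-insertAt X       f       Fin.zero    s x = circSum-∷ s x X f
circSum-insertAt (t ∷ X) (y ∷ f) (Fin.suc a) s x = begin
  circSum (t ∷ Vec.insertAt X a s) (y ∷ Vec.insertAt f a x)   ≡⟨ circSum-∷ t y _ _ ⟩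
  signed t y ℤ.+ circSum (Vec.insertAt X a s) (Vec.insertAt f a x)
    ≡⟨ cong (ℤ._+_ (signed t y)) (circSum-insertAt X f a s x) ⟩
  signed t y ℤ.+ (signed s x ℤ.+ circSum X f)                 ≡⟨ ℤ-x∙yz≈y∙xz (signed t y) (signed s x) (circSum X f) ⟩
  signed s x ℤ.+ (signed t y ℤ.+ circSum X f)                 ≡⟨ cong (ℤ._+_ (signed s x)) (circSum-∷ t y X f) ⟨
  signed s x ℤ.+ circSum (t ∷ X) (y ∷ f)                      ∎

circSum-removeAt : ∀ {q m} (X : SignVec (suc m)) (f : Coflow q m) a x →
                   circSum X (Vec.insertAt f a x) ≡ signed (Vec.lookup X a) x ℤ.+ circSum (Vec.removeAt X a) f
circSum-removeAt X f a x = begin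
  circSum X (Vec.insertAt f a x)
    ≡⟨ cong (λ Y → circSum Y (Vec.insertAt f a x)) (Vecₚ.insertAt-removeAt X a) ⟨
  circSum (Vec.insertAt (Vec.removeAt X a) a (Vec.lookup X a)) (Vec.insertAt f a x)
    ≡⟨ circSum-insertAt (Vec.removeAt X a) f a (Vec.lookup X a) x ⟩
  signed (Vec.lookup X a) x ℤ.+ circSum (Vec.removeAt X a) f ∎

circSum-◯ : ∀ {q n} (X : SignVec n) (f : Coflow q n) → (∀ i → Vec.lookup X i ≡ ◯) → circSum X f ≡ + 0
circSum-◯ []      []      X≡◯ = refl
circSum-◯ (s ∷ X) (x ∷ f) X≡◯ with X≡◯ Fin.zero
... | refl = circSum-◯ X f (X≡◯ ∘ Fin.suc)

circSum-++ : ∀ {q m n} (X : SignVec m) (Y : SignVec n) (f : Coflow q m) g →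
             circSum (X Vec.++ Y) (f Vec.++ g) ≡ circSum X f ℤ.+ circSum Y g
circSum-++ []      Y []      g = sym (ℤₚ.+-identityˡ _)
circSum-++ (s ∷ X) Y (x ∷ f) g = begin
  circSum (s ∷ X Vec.++ Y) (x ∷ f Vec.++ g)             ≡⟨ circSum-∷ s x _ _ ⟩
  signed s x ℤ.+ circSum (X Vec.++ Y) (f Vec.++ g)      ≡⟨ cong (ℤ._+_ (signed s x)) (circSum-++ X Y f g) ⟩
  signed s x ℤ.+ (circSum X f ℤ.+ circSum Y g)          ≡⟨ ℤₚ.+-assoc (signed s x) _ _ ⟨
  (signed s x ℤ.+ circSum X f) ℤ.+ circSum Y g          ≡⟨ cong (ℤ._+ circSum Y g) (circSum-∷ s x X f) ⟨
  circSum (s ∷ X) (x ∷ f) ℤ.+ circSum Y g               ∎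

negate : ∀ {q} → Fin q → Fin q
negate {suc k} Fin.zero    = Fin.zero
negate {suc k} (Fin.suc i) = Fin.suc (Fin.opposite i)

negate-involutive : ∀ {q} (x : Fin q) → negate (negate x) ≡ x
negate-involutive {suc k} Fin.zero    = refl
negate-involutive {suc k} (Fin.suc i) = cong Fin.suc (Finₚ.opposite-involutive i)

∑-negate : ∀ {q} (g : Fin q → ℚ) → sum (g ∘ negate) ≡ sum g
∑-negate g = sym (∑-permute g (permutation negate negate negate-involutive negate-involutive))

∣-toℕ+toℕ-negate : ∀ {q} (x : Fin q) → + q ∣ + toℕ x ℤ.+ + toℕ (negate x)
∣-toℕ+toℕ-negate {suc k} Fin.zero    = divides (+ 0) refl
∣-toℕ+toℕ-negate {suc k} (Fin.suc i) = divides (+ 1) (begin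
  + suc (toℕ i) ℤ.+ + suc (toℕ (Fin.opposite i))   ≡⟨ ℤₚ.pos-+ (suc (toℕ i)) _ ⟨
  + (suc (toℕ i) ℕ.+ suc (toℕ (Fin.opposite i)))   ≡⟨ cong (λ m → + (suc (toℕ i) ℕ.+ suc m)) (Finₚ.opposite-prop i) ⟩
  + (suc (toℕ i) ℕ.+ suc (k ℕ.∸ suc (toℕ i)))      ≡⟨ cong (λ m → + m) (ℕₚ.+-suc (suc (toℕ i)) _) ⟩
  + suc (suc (toℕ i) ℕ.+ (k ℕ.∸ suc (toℕ i)))      ≡⟨ cong (λ m → + suc m) (ℕₚ.m+[n∸m]≡n (Finₚ.toℕ<n i)) ⟩
  + suc k                                           ≡⟨ ℤₚ.*-identityˡ (+ suc k) ⟨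
  + 1 ℤ.* + suc k                                   ∎)

∣-signed+signed-negate : ∀ {q} s (x : Fin q) → + q ∣ signed s x ℤ.+ signed s (negate x)
∣-signed+signed-negate ⊕ x = ∣-toℕ+toℕ-negate x
∣-signed+signed-negate ⊖ x = subst (_ ∣_) (ℤₚ.neg-distrib-+ (+ toℕ x) _) (ℤ∣.∣m⇒∣-m (∣-toℕ+toℕ-negate x))
∣-signed+signed-negate ◯ x = divides (+ 0) refl

∣-circSum+circSum-negate : ∀ {q n} (X : SignVec n) (f : Coflow q n) →
                           + q ∣ circSum X f ℤ.+ circSum X (Vec.map negate f)
∣-circSum+circSum-negate []      []      = divides (+ 0) refl
∣-circSum+circSum-negate (s ∷ X) (x ∷ f) = subst (_ ∣_) (begin
  (signed s x ℤ.+ signed s (negate x)) ℤ.+ (circSum X f ℤ.+ circSum X (Vec.map negate f))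
    ≡⟨ ℤ-interchange (signed s x) _ _ _ ⟩
  (signed s x ℤ.+ circSum X f) ℤ.+ (signed s (negate x) ℤ.+ circSum X (Vec.map negate f))
    ≡⟨ cong₂ ℤ._+_ (circSum-∷ s x X f) (circSum-∷ s (negate x) X (Vec.map negate f)) ⟨
  circSum (s ∷ X) (x ∷ f) ℤ.+ circSum (s ∷ X) (negate x ∷ Vec.map negate f) ∎)
  (ℤ∣.∣m∣n⇒∣m+n (∣-signed+signed-negate s x) (∣-circSum+circSum-negate X f))

isCoflowᵇ-negate : ∀ {n} q (N : OM n) f → isCoflowᵇ q N (Vec.map negate f) ≡ isCoflowᵇ q N f
isCoflowᵇ-negate q N f = isCoflowᵇ-cong q {N} {N} (mk⇔
  (λ -f-coflow {X} X∈N → ℤ∣.∣m+n∣n⇒∣m (∣-circSum+circSum-negate X f) (-f-coflow X∈N))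
  (λ f-coflow {X} X∈N → ℤ∣.∣m+n∣m⇒∣n (∣-circSum+circSum-negate X f) (f-coflow X∈N)))

isPosᵇ-negate : ∀ {q} (x : Fin q) → isPosᵇ (negate x) ≡ isNegᵇ x
isPosᵇ-negate {suc k} Fin.zero    = refl
isPosᵇ-negate {suc k} (Fin.suc i) = cong (λ m → m ℕ.≤ᵇ suc k ℕ./ 2) (begin
  suc (toℕ (Fin.opposite i))   ≡⟨ cong suc (Finₚ.opposite-prop i) ⟩
  suc (k ℕ.∸ suc (toℕ i))      ≡⟨ ℕₚ.+-∸-assoc 1 (Finₚ.toℕ<n i) ⟨
  k ℕ.∸ toℕ i                  ∎)

isNegᵇ-negate : ∀ {q} (x : Fin q) → isNegᵇ (negate x) ≡ isPosᵇ x
isNegᵇ-negate x = trans (sym (isPosᵇ-negate (negate x))) (cong isPosᵇ (negate-involutive x))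

#>-negate : ∀ {q n} (f : Coflow q n) → #> (Vec.map negate f) ≡ #< f
#>-negate f = trans (countᵇ-map isPosᵇ negate f) (countᵇ-cong isPosᵇ-negate f)

#<-negate : ∀ {q n} (f : Coflow q n) → #< (Vec.map negate f) ≡ #> f
#<-negate f = trans (countᵇ-map isNegᵇ negate f) (countᵇ-cong isNegᵇ-negate f)

_⊆ˢ_ : ∀ {n} → SignVec n → SignVec n → Set
X ⊆ˢ Y = ∀ i → Vec.lookup Y i ≡ ◯ → Vec.lookup X i ≡ ◯

sgn≡◯⇒≡0 : ∀ z → sgn z ≡ ◯ → z ≡ + 0
sgn≡◯⇒≡0 (+ zero) _ = refl

circuit-⊆ˢ-minimal : ∀ {n} {N : OM n} → Regular N → ∀ {X Y} → X ∈ N → Y ∈ N → Y ⊆ˢ X → X ⊆ˢ Y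
circuit-⊆ˢ-minimal (_ , _ , _ , circuits) {X} {Y} X∈N Y∈N Y⊆X i Yᵢ≡◯ =
  let (v , _ , sgn-v , _ , v-minimal) = proj₁ (circuits X) X∈N
      (w , w∈ker , sgn-w , w≢0 , _) = proj₁ (circuits Y) Y∈N
      w≡0 : ∀ j → Vec.lookup Y j ≡ ◯ → w j ≡ + 0
      w≡0 j Yⱼ≡◯ = sgn≡◯⇒≡0 (w j) (trans (sgn-w j) Yⱼ≡◯)
      supp-w⊆supp-v : ∀ j → v j ≡ + 0 → w j ≡ + 0
      supp-w⊆supp-v j vⱼ≡0 = w≡0 j (Y⊆X j (trans (sym (sgn-v j)) (cong sgn vⱼ≡0)))
  in trans (sym (sgn-v i)) (cong sgn (v-minimal w w∈ker w≢0 supp-w⊆supp-v i (w≡0 i Yᵢ≡◯)))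

lookup-removeAt : ∀ {A : Set} {n} (X : Vec A (suc n)) a i →
                  Vec.lookup (Vec.removeAt X a) i ≡ Vec.lookup X (Fin.punchIn a i)
lookup-removeAt X a i = trans (sym (Vecₚ.insertAt-punchIn (Vec.removeAt X a) a (Vec.lookup X a) i))
                              (cong (λ Y → Vec.lookup Y (Fin.punchIn a i)) (Vecₚ.insertAt-removeAt X a))

loop-circuit : ∀ {m} {N : OM (suc m)} {a} → Regular N → IsLoop N a →
               ∀ {X} → X ∈ N → Vec.lookup X a ≢ ◯ → ∀ i → Vec.lookup (Vec.removeAt X a) i ≡ ◯
loop-circuit {a = a} reg (L , L∈N , _ , L≡◯) {X} X∈N Xₐ≢◯ i =
  trans (lookup-removeAt X a i)
        (circuit-⊆ˢ-minimal reg X∈N L∈N L⊆X (Fin.punchIn a i) (L≡◯ _ (Finₚ.punchInᵢ≢i a i)))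
  where
  L⊆X : L ⊆ˢ X
  L⊆X j Xⱼ≡◯ = L≡◯ j (λ { refl → Xₐ≢◯ Xⱼ≡◯ })

⊆ˢ-removeAt⁺ : ∀ {n} {X Y : SignVec (suc n)} a → X ⊆ˢ Y → Vec.removeAt X a ⊆ˢ Vec.removeAt Y a
⊆ˢ-removeAt⁺ {X = X} {Y} a X⊆Y i Yᵢ≡◯ =
  trans (lookup-removeAt X a i) (X⊆Y _ (trans (sym (lookup-removeAt Y a i)) Yᵢ≡◯))

⊆ˢ-removeAt⁻ : ∀ {n} {X Y : SignVec (suc n)} a → Vec.lookup X a ≡ ◯ →
               Vec.removeAt X a ⊆ˢ Vec.removeAt Y a → X ⊆ˢ Y
⊆ˢ-removeAt⁻ {X = X} {Y} a Xₐ≡◯ X⊆Y i Yᵢ≡◯ with a Finₚ.≟ i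
... | yes refl = Xₐ≡◯
... | no a≢i   = begin
  Vec.lookup X i                                  ≡⟨ cong (Vec.lookup X) (Finₚ.punchIn-punchOut a≢i) ⟨
  Vec.lookup X (Fin.punchIn a (Fin.punchOut a≢i)) ≡⟨ lookup-removeAt X a _ ⟨
  Vec.lookup (Vec.removeAt X a) (Fin.punchOut a≢i)
    ≡⟨ X⊆Y _ (trans (lookup-removeAt Y a _) (trans (cong (Vec.lookup Y) (Finₚ.punchIn-punchOut a≢i)) Yᵢ≡◯)) ⟩
  ◯                                               ∎

suppSubᵇ⇒⊆ˢ : ∀ {n} (X Y : SignVec n) → T (suppSubᵇ X Y) → X ⊆ˢ Y
suppSubᵇ⇒⊆ˢ (◯ ∷ X) (◯ ∷ Y) _  Fin.zero    refl = refl
suppSubᵇ⇒⊆ˢ (⊕ ∷ X) (◯ ∷ Y) () Fin.zero    refl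
suppSubᵇ⇒⊆ˢ (⊖ ∷ X) (◯ ∷ Y) () Fin.zero    refl
suppSubᵇ⇒⊆ˢ (x ∷ X) (y ∷ Y) t  (Fin.suc i) =
  suppSubᵇ⇒⊆ˢ X Y (proj₂ (Equivalence.to (Boolₚ.T-∧ {isZ x ∨ not (isZ y)}) t)) i

⊆ˢ⇒suppSubᵇ : ∀ {n} (X Y : SignVec n) → X ⊆ˢ Y → T (suppSubᵇ X Y)
⊆ˢ⇒suppSubᵇ []      []      _   = _
⊆ˢ⇒suppSubᵇ (x ∷ X) (y ∷ Y) X⊆Y =
  Equivalence.from Boolₚ.T-∧ (head x y (X⊆Y Fin.zero) , ⊆ˢ⇒suppSubᵇ X Y (X⊆Y ∘ Fin.suc))
  where
  head : ∀ x y → (y ≡ ◯ → x ≡ ◯) → T (isZ x ∨ not (isZ y))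
  head ◯ y _ = _
  head ⊕ ⊕ _ = _
  head ⊕ ⊖ _ = _
  head ⊖ ⊕ _ = _
  head ⊖ ⊖ _ = _
  head ⊕ ◯ y≡◯⇒x≡◯ with () ← y≡◯⇒x≡◯ refl
  head ⊖ ◯ y≡◯⇒x≡◯ with () ← y≡◯⇒x≡◯ refl

nonzeroᵇ≡false : ∀ {n} (X : SignVec n) → nonzeroᵇ X ≡ false → ∀ i → Vec.lookup X i ≡ ◯
nonzeroᵇ≡false (◯ ∷ X) X≡0 Fin.zero    = refl
nonzeroᵇ≡false (◯ ∷ X) X≡0 (Fin.suc i) = nonzeroᵇ≡false X X≡0 i

signed-zero : ∀ {k} s → signed {suc k} s Fin.zero ≡ + 0
signed-zero ⊕ = refl
signed-zero ⊖ = refl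
signed-zero ◯ = refl

∤-signed-suc : ∀ {k} s (i : Fin k) → s ≢ ◯ → ¬ (+ suc k ∣ signed s (Fin.suc i))
∤-signed-suc ⊕ i _   q∣ = ℕₚ.<⇒≱ (s≤s (Finₚ.toℕ<n i)) (ℕ∣.∣⇒≤ (ℤ∣.∣⇒∣ᵤ q∣))
∤-signed-suc ⊖ i _   q∣ = ℕₚ.<⇒≱ (s≤s (Finₚ.toℕ<n i)) (ℕ∣.∣⇒≤ (ℤ∣.∣⇒∣ᵤ q∣))
∤-signed-suc ◯ i s≢◯ _  = s≢◯ refl

circSum-insertAt-◯ : ∀ {q m} (X : SignVec (suc m)) (f : Coflow q m) a x → Vec.lookup X a ≡ ◯ →
                     circSum X (Vec.insertAt f a x) ≡ circSum (Vec.removeAt X a) f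
circSum-insertAt-◯ X f a x Xₐ≡◯ = begin
  circSum X (Vec.insertAt f a x)                                 ≡⟨ circSum-removeAt X f a x ⟩
  signed (Vec.lookup X a) x ℤ.+ circSum (Vec.removeAt X a) f
    ≡⟨ cong (λ s → signed s x ℤ.+ circSum (Vec.removeAt X a) f) Xₐ≡◯ ⟩
  + 0 ℤ.+ circSum (Vec.removeAt X a) f                           ≡⟨ ℤₚ.+-identityˡ _ ⟩
  circSum (Vec.removeAt X a) f                                   ∎

circSum-insertAt-zero : ∀ {k m} (X : SignVec (suc m)) (f : Coflow (suc k) m) a →
                        circSum X (Vec.insertAt f a Fin.zero) ≡ circSum (Vec.removeAt X a) f
circSum-insertAt-zero X f a = begin
  circSum X (Vec.insertAt f a Fin.zero)                              ≡⟨ circSum-removeAt X f a Fin.zero ⟩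
  signed (Vec.lookup X a) Fin.zero ℤ.+ circSum (Vec.removeAt X a) f
    ≡⟨ cong (ℤ._+ circSum (Vec.removeAt X a) f) (signed-zero (Vec.lookup X a)) ⟩
  + 0 ℤ.+ circSum (Vec.removeAt X a) f                               ≡⟨ ℤₚ.+-identityˡ _ ⟩
  circSum (Vec.removeAt X a) f                                       ∎

module _ {m} {N : OM (suc m)} {a : Fin (suc m)} (reg : Regular N) where

  private
    Zₐ? = λ (X : SignVec (suc m)) → isZ (Vec.lookup X a) Bool.≟ true

  loop-coflow-zero : IsLoop N a → ∀ {k} (f : Coflow (suc k) m) →
                     IsCoflow (suc k) N (Vec.insertAt f a Fin.zero) ⇔ IsCoflow (suc k) (deletion N a) f
  loop-coflow-zero loop {k} f = mk⇔ to from
    where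
    to : IsCoflow (suc k) N (Vec.insertAt f a Fin.zero) → IsCoflow (suc k) (deletion N a) f
    to f-coflow Y∈N∖a with ∈ₚ.∈-map⁻ (λ X → Vec.removeAt X a) Y∈N∖a
    ... | X , X∈filter , refl =
      subst (_ ∣_) (circSum-insertAt-zero X f a) (f-coflow (proj₁ (∈ₚ.∈-filter⁻ Zₐ? {xs = N} X∈filter)))
    from : IsCoflow (suc k) (deletion N a) f → IsCoflow (suc k) N (Vec.insertAt f a Fin.zero)
    from f-coflow {X} X∈N with isZ (Vec.lookup X a) in Xₐ
    ... | true  = subst (_ ∣_) (sym (circSum-insertAt-zero X f a))
                    (f-coflow (∈ₚ.∈-map⁺ (λ X → Vec.removeAt X a) (∈ₚ.∈-filter⁺ Zₐ? X∈N Xₐ)))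
    ... | false = subst (_ ∣_)
                    (sym (trans (circSum-insertAt-zero X f a)
                      (circSum-◯ (Vec.removeAt X a) f
                        (loop-circuit reg loop X∈N (λ Xₐ≡◯ → case trans (sym Xₐ) (cong isZ Xₐ≡◯) of λ ())))))
                    (divides (+ 0) refl)

  loop-not-coflow : IsLoop N a → ∀ {k} (f : Coflow (suc k) m) i → ¬ IsCoflow (suc k) N (Vec.insertAt f a (Fin.suc i))
  loop-not-coflow (L , L∈N , Lₐ≢◯ , L≡◯) f i f-coflow = ∤-signed-suc (Vec.lookup L a) i Lₐ≢◯
    (subst (_ ∣_) (begin
      circSum L (Vec.insertAt f a (Fin.suc i))                                ≡⟨ circSum-removeAt L f a (Fin.suc i) ⟩
      signed (Vec.lookup L a) (Fin.suc i) ℤ.+ circSum (Vec.removeAt L a) f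
        ≡⟨ cong (ℤ._+_ (signed (Vec.lookup L a) (Fin.suc i))) (circSum-◯ (Vec.removeAt L a) f L∖a≡◯) ⟩
      signed (Vec.lookup L a) (Fin.suc i) ℤ.+ + 0                             ≡⟨ ℤₚ.+-identityʳ _ ⟩
      signed (Vec.lookup L a) (Fin.suc i)                                     ∎) (f-coflow L∈N))
    where
    L∖a≡◯ : ∀ j → Vec.lookup (Vec.removeAt L a) j ≡ ◯
    L∖a≡◯ j = trans (lookup-removeAt L a j) (L≡◯ _ (Finₚ.punchInᵢ≢i a j))

  private
    rm : SignVec (suc m) → SignVec m
    rm X = Vec.removeAt X a
    Nonzero? = λ (Y : SignVec m) → nonzeroᵇ Y Bool.≟ true
    candidates = List.filter Nonzero? (List.map rm N)
    Minimal? = λ (Y : SignVec m) → any (λ Z → suppStrictᵇ Z Y) candidates Bool.≟ false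

  -- No C′ ∖ a is strictly inside C ∖ a: otherwise supp C′ ⊊ supp C, as a lies on no circuit.
  candidate-minimal : IsColoop N a → ∀ {X} → X ∈ N → ¬ T (any (λ Z → suppStrictᵇ Z (rm X)) candidates)
  candidate-minimal coloop {X} X∈N smaller
    with Z , Z∈cands , Z⊂X ← find (Anyₚ.any⁻ _ candidates smaller)
    with X′ , X′∈N , refl ← ∈ₚ.∈-map⁻ rm (proj₁ (∈ₚ.∈-filter⁻ Nonzero? {xs = List.map rm N} Z∈cands))
    = let (X′∖a⊆X∖a , X∖a⊈X′∖a) = Equivalence.to (Boolₚ.T-∧ {suppSubᵇ (rm X′) (rm X)}) Z⊂X
          X′⊆X = ⊆ˢ-removeAt⁻ {X = X′} {X} a (coloop X′ X′∈N) (suppSubᵇ⇒⊆ˢ (rm X′) (rm X) X′∖a⊆X∖a)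
          X⊆X′ = circuit-⊆ˢ-minimal reg X∈N X′∈N X′⊆X
      in T-not⇒¬T X∖a⊈X′∖a (⊆ˢ⇒suppSubᵇ (rm X) (rm X′) (⊆ˢ-removeAt⁺ {X = X} {X′} a X⊆X′))

  coloop-coflow : IsColoop N a → ∀ {q} (f : Coflow q m) x →
                  IsCoflow q N (Vec.insertAt f a x) ⇔ IsCoflow q (contraction N a) f
  coloop-coflow coloop {q} f x = mk⇔ to from
    where
    to : IsCoflow q N (Vec.insertAt f a x) → IsCoflow q (contraction N a) f
    to f-coflow Y∈N/a
      with X , X∈N , refl ← ∈ₚ.∈-map⁻ rm (proj₁ (∈ₚ.∈-filter⁻ Nonzero? {xs = List.map rm N}
                                (proj₁ (∈ₚ.∈-filter⁻ Minimal? {xs = candidates} Y∈N/a))))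
      = subst (_ ∣_) (circSum-insertAt-◯ X f a x (coloop X X∈N)) (f-coflow X∈N)
    from : IsCoflow q (contraction N a) f → IsCoflow q N (Vec.insertAt f a x)
    from f-coflow {X} X∈N = subst (_ ∣_) (sym (circSum-insertAt-◯ X f a x (coloop X X∈N))) X∖a-coflow
      where
      X∖a-coflow : + q ∣ circSum (rm X) f
      X∖a-coflow with nonzeroᵇ (rm X) in nonzero
      ... | false = subst (_ ∣_) (sym (circSum-◯ (rm X) f (nonzeroᵇ≡false (rm X) nonzero))) (divides (+ 0) refl)
      ... | true with any (λ Z → suppStrictᵇ Z (rm X)) candidates in smaller
      ...   | true  = ⊥-elim (candidate-minimal coloop X∈N (subst T (sym smaller) _))
      ...   | false = f-coflow (∈ₚ.∈-filter⁺ Minimal? (∈ₚ.∈-filter⁺ Nonzero? (∈ₚ.∈-map⁺ rm X∈N) nonzero) smaller)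

union-coflow : ∀ {n₁ n₂} q (N₁ : OM n₁) (N₂ : OM n₂) f g →
               IsCoflow q (disjointUnion N₁ N₂) (f Vec.++ g) ⇔ (IsCoflow q N₁ f × IsCoflow q N₂ g)
union-coflow {n₁} {n₂} q N₁ N₂ f g = mk⇔
  (λ fg-coflow → (λ {X} X∈N₁ → subst (_ ∣_) (circSum-left X f)
                             (fg-coflow (∈ₚ.∈-++⁺ˡ (∈ₚ.∈-map⁺ (Vec._++ Vec.replicate n₂ ◯) X∈N₁))))
               , (λ {X} X∈N₂ → subst (_ ∣_) (circSum-right X g)
                             (fg-coflow (∈ₚ.∈-++⁺ʳ (List.map _ N₁) (∈ₚ.∈-map⁺ (Vec.replicate n₁ ◯ Vec.++_) X∈N₂)))))
  (λ (f-coflow , g-coflow) {X} X∈N → case ∈ₚ.∈-++⁻ (List.map _ N₁) X∈N of λ where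
    (inj₁ X∈N₁) → case ∈ₚ.∈-map⁻ _ X∈N₁ of λ where
      (X , X∈N₁ , refl) → subst (_ ∣_) (sym (circSum-left X f)) (f-coflow X∈N₁)
    (inj₂ X∈N₂) → case ∈ₚ.∈-map⁻ _ X∈N₂ of λ where
      (X , X∈N₂ , refl) → subst (_ ∣_) (sym (circSum-right X g)) (g-coflow X∈N₂))
  where
  circSum-◯s : ∀ {n} (h : Coflow q n) → circSum (Vec.replicate n ◯) h ≡ + 0
  circSum-◯s {n} h = circSum-◯ (Vec.replicate n ◯) h (λ i → Vecₚ.lookup-replicate i ◯)
  circSum-left : ∀ X f → circSum (X Vec.++ Vec.replicate n₂ ◯) (f Vec.++ g) ≡ circSum X f
  circSum-left X f = trans (circSum-++ X _ f g) (trans (cong (ℤ._+_ (circSum X f)) (circSum-◯s g)) (ℤₚ.+-identityʳ _))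
  circSum-right : ∀ X g → circSum (Vec.replicate n₁ ◯ Vec.++ X) (f Vec.++ g) ≡ circSum X g
  circSum-right X g = trans (circSum-++ (Vec.replicate n₁ ◯) X f g) (trans (cong (ℤ._+ circSum X g) (circSum-◯s f)) (ℤₚ.+-identityˡ _))

half-odd : ∀ t → suc (2 ℕ.* t) ℕ./ 2 ≡ t
half-odd t = begin
  suc (2 ℕ.* t) ℕ./ 2    ≡⟨ cong (ℕ._/ 2) (trans (cong suc (ℕₚ.*-comm 2 t)) (ℕₚ.+-comm 1 (t ℕ.* 2))) ⟩
  (t ℕ.* 2 ℕ.+ 1) ℕ./ 2
    ≡⟨ ℕDivMod.+-distrib-/ (t ℕ.* 2) 1 (subst (λ r → r ℕ.+ 1 < 2) (sym (ℕDivMod.m*n%n≡0 t 2)) ℕₚ.≤-refl) ⟩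
  t ℕ.* 2 ℕ./ 2 ℕ.+ 0    ≡⟨ ℕₚ.+-identityʳ _ ⟩
  t ℕ.* 2 ℕ./ 2          ≡⟨ ℕDivMod.m*n/n≡m t 2 ⟩
  t                      ∎

2t≡t+t : ∀ t → 2 ℕ.* t ≡ t ℕ.+ t
2t≡t+t t = cong (t ℕ.+_) (ℕₚ.+-identityʳ t)

2t∸m≤ᵇt : ∀ t m → (2 ℕ.* t ℕ.∸ m ℕ.≤ᵇ t) ≡ not (m ℕ.<ᵇ t)
2t∸m≤ᵇt t m with m ℕ.<ᵇ t in m<ᵇt
... | true  = ¬T⇒≡false (λ 2t∸m≤ᵇt → ℕₚ.<-irrefl refl (ℕₚ.≤-<-trans (ℕₚ.m≤n+m∸n (2 ℕ.* t) m)
  (subst (m ℕ.+ (2 ℕ.* t ℕ.∸ m) <_) (sym (2t≡t+t t))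
    (ℕₚ.+-mono-<-≤ (ℕₚ.<ᵇ⇒< m t (subst T (sym m<ᵇt) _)) (ℕₚ.≤ᵇ⇒≤ _ t 2t∸m≤ᵇt)))))
... | false = T⇒≡true (ℕₚ.≤⇒≤ᵇ (ℕₚ.≤-trans
  (ℕₚ.∸-monoʳ-≤ {t} {m} (2 ℕ.* t) (ℕₚ.≮⇒≥ (λ m<t → subst T m<ᵇt (ℕₚ.<⇒<ᵇ m<t))))
  (ℕₚ.≤-reflexive (trans (cong (ℕ._∸ t) (2t≡t+t t)) (ℕₚ.m+n∸m≡n t t)))))

odd-half : ∀ t → (ι (suc (2 ℕ.* t)) - 1ℚ) * ½ ≡ ι t
odd-half t = begin
  (ι (suc (2 ℕ.* t)) - 1ℚ) * ½        ≡⟨ cong (λ u → (u - 1ℚ) * ½) (trans (ι-suc (2 ℕ.* t)) (cong (ℚ._+_ 1ℚ)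
                                            (trans (cong ι (2t≡t+t t)) (ι-+ t t)))) ⟩
  (1ℚ + (ι t + ι t) - 1ℚ) * ½         ≡⟨ solve 2 (λ a h → (con 1ℚ :+ (a :+ a) :- con 1ℚ) :* h := a :* (h :+ h)) refl (ι t) ½ ⟩
  ι t * (½ + ½)                       ≡⟨ ℚₚ.*-identityʳ (ι t) ⟩
  ι t                                 ∎
  where open +-*-Solver

isPosᵇ-odd : ∀ t (i : Fin (2 ℕ.* t)) → isPosᵇ {suc (2 ℕ.* t)} (Fin.suc i) ≡ (toℕ i ℕ.<ᵇ t)
isPosᵇ-odd t i = cong (suc (toℕ i) ℕ.≤ᵇ_) (half-odd t)

isNegᵇ-odd : ∀ t (i : Fin (2 ℕ.* t)) → isNegᵇ {suc (2 ℕ.* t)} (Fin.suc i) ≡ not (toℕ i ℕ.<ᵇ t)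
isNegᵇ-odd t i = trans (cong (2 ℕ.* t ℕ.∸ toℕ i ℕ.≤ᵇ_) (half-odd t)) (2t∸m≤ᵇt t (toℕ i))

#=+#>+#<-odd : ∀ t {n} (f : Coflow (suc (2 ℕ.* t)) n) → #= f ℕ.+ #> f ℕ.+ #< f ≡ n
#=+#>+#<-odd t []            = refl
#=+#>+#<-odd t {suc n} (x ∷ f) = begin
  #= (x ∷ f) ℕ.+ #> (x ∷ f) ℕ.+ #< (x ∷ f)
    ≡⟨ cong₂ ℕ._+_ (cong₂ ℕ._+_ (countᵇ-∷ isZeroᵇ x f) (countᵇ-∷ isPosᵇ x f)) (countᵇ-∷ isNegᵇ x f) ⟩
  (boolToℕ (isZeroᵇ x) ℕ.+ #= f) ℕ.+ (boolToℕ (isPosᵇ x) ℕ.+ #> f) ℕ.+ (boolToℕ (isNegᵇ x) ℕ.+ #< f)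
    ≡⟨ solve 6 (λ a b c d e g → (a :+ d) :+ (b :+ e) :+ (c :+ g) := (a :+ b :+ c) :+ (d :+ e :+ g)) refl
         (boolToℕ (isZeroᵇ x)) (boolToℕ (isPosᵇ x)) (boolToℕ (isNegᵇ x)) (#= f) (#> f) (#< f) ⟩
  (boolToℕ (isZeroᵇ x) ℕ.+ boolToℕ (isPosᵇ x) ℕ.+ boolToℕ (isNegᵇ x)) ℕ.+ (#= f ℕ.+ #> f ℕ.+ #< f)
    ≡⟨ cong₂ ℕ._+_ (exactly-one x) (#=+#>+#<-odd t f) ⟩
  suc n ∎
  where
  open ℕSolver.+-*-Solver
  exactly-one : ∀ x → boolToℕ (isZeroᵇ x) ℕ.+ boolToℕ (isPosᵇ x) ℕ.+ boolToℕ (isNegᵇ x) ≡ 1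
  exactly-one Fin.zero    = refl
  exactly-one (Fin.suc i) rewrite isPosᵇ-odd t i | isNegᵇ-odd t i with toℕ i ℕ.<ᵇ t
  ... | true  = refl
  ... | false = refl

#≥≡#>+#= : ∀ {q n} (f : Coflow q n) → #≥ f ≡ #> f ℕ.+ #= f
#≥≡#>+#= = countᵇ-∨ isPosᵇ isZeroᵇ λ { Fin.zero → refl ; (Fin.suc _) → Boolₚ.∧-zeroʳ _ }

#≤≡#<+#= : ∀ {q n} (f : Coflow q n) → #≤ f ≡ #< f ℕ.+ #= f
#≤≡#<+#= = countᵇ-∨ isNegᵇ isZeroᵇ λ { Fin.zero → refl ; (Fin.suc _) → Boolₚ.∧-zeroʳ _ }

weight : ∀ {q n} → ℚ → ℚ → Coflow q n → ℚ
weight y z f = (y ^ℚ #> f) * (z ^ℚ #< f)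

weight-++ : ∀ {q m n} y z (f : Coflow q m) (g : Coflow q n) →
            weight y z (f Vec.++ g) ≡ weight y z f * weight y z g
weight-++ y z f g = begin
  (y ^ℚ #> (f Vec.++ g)) * (z ^ℚ #< (f Vec.++ g))
    ≡⟨ cong₂ (λ a b → (y ^ℚ a) * (z ^ℚ b)) (countᵇ-++ isPosᵇ f g) (countᵇ-++ isNegᵇ f g) ⟩
  (y ^ℚ (#> f ℕ.+ #> g)) * (z ^ℚ (#< f ℕ.+ #< g))
    ≡⟨ cong₂ _*_ (^ℚ-+ y (#> f) (#> g)) (^ℚ-+ z (#< f) (#< g)) ⟩
  ((y ^ℚ #> f) * (y ^ℚ #> g)) * ((z ^ℚ #< f) * (z ^ℚ #< g))
    ≡⟨ solve 4 (λ a b c d → (a :* b) :* (c :* d) := (a :* c) :* (b :* d)) refl (y ^ℚ #> f) (y ^ℚ #> g) (z ^ℚ #< f) (z ^ℚ #< g) ⟩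
  weight y z f * weight y z g ∎
  where open +-*-Solver

∑-const : ∀ k c → ∑[ i < k ] c ≡ ι k * c
∑-const zero    c = sym (ℚₚ.*-zeroˡ c)
∑-const (suc k) c = begin
  c + ∑[ i < k ] c   ≡⟨ cong (ℚ._+_ c) (∑-const k c) ⟩
  c + ι k * c        ≡⟨ solve 2 (λ c m → c :+ m :* c := (con 1ℚ :+ m) :* c) refl c (ι k) ⟩
  (1ℚ + ι k) * c     ≡⟨ cong (_* c) (ι-suc k) ⟨
  ι (suc k) * c      ∎
  where open +-*-Solver

∑-splitAt : ∀ m n (h : Fin (m ℕ.+ n) → ℚ) → sum h ≡ ∑[ i < m ] h (i Fin.↑ˡ n) + ∑[ j < n ] h (m Fin.↑ʳ j)
∑-splitAt zero    n h = sym (ℚₚ.+-identityˡ _)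
∑-splitAt (suc m) n h = trans (cong (ℚ._+_ (h Fin.zero)) (∑-splitAt m n (h ∘ Fin.suc))) (sym (ℚₚ.+-assoc (h Fin.zero) _ _))

-- Of the 2t nonzero residues, the first t are positive and the last t negative.
∑-weight-odd : ∀ t y z → ∑[ x < suc (2 ℕ.* t) ] weight y z (x ∷ []) ≡ 1ℚ + ι t * (y + z)
∑-weight-odd t y z = begin
  1ℚ * 1ℚ + ∑[ i < t ℕ.+ (t ℕ.+ 0) ] w (Fin.suc i)
    ≡⟨ cong (ℚ._+_ 1ℚ) (∑-splitAt t (t ℕ.+ 0) (w ∘ Fin.suc)) ⟩
  1ℚ + (∑[ i < t ] w (Fin.suc (i Fin.↑ˡ (t ℕ.+ 0))) + ∑[ j < t ℕ.+ 0 ] w (Fin.suc (t Fin.↑ʳ j)))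
    ≡⟨ cong (ℚ._+_ 1ℚ) (cong₂ _+_ (sum-cong-≗ positive) (sum-cong-≗ negative)) ⟩
  1ℚ + (∑[ i < t ] y + ∑[ j < t ℕ.+ 0 ] z)
    ≡⟨ cong (ℚ._+_ 1ℚ) (cong₂ _+_ (∑-const t y)
         (trans (∑-const (t ℕ.+ 0) z) (cong (λ k → ι k * z) (ℕₚ.+-identityʳ t)))) ⟩
  1ℚ + (ι t * y + ι t * z)
    ≡⟨ cong (ℚ._+_ 1ℚ) (ℚₚ.*-distribˡ-+ (ι t) y z) ⟨
  1ℚ + ι t * (y + z) ∎
  where
  w : Fin (suc (2 ℕ.* t)) → ℚ
  w x = weight y z (x ∷ [])
  w-suc : (i : Fin (2 ℕ.* t)) → w (Fin.suc i) ≡ (y ^ℚ boolToℕ (toℕ i ℕ.<ᵇ t)) * (z ^ℚ boolToℕ (not (toℕ i ℕ.<ᵇ t)))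
  w-suc i = cong₂ (λ a b → (y ^ℚ boolToℕ a) * (z ^ℚ boolToℕ b)) (isPosᵇ-odd t i) (isNegᵇ-odd t i)
  positive : (i : Fin t) → w (Fin.suc (i Fin.↑ˡ (t ℕ.+ 0))) ≡ y
  positive i rewrite w-suc (i Fin.↑ˡ (t ℕ.+ 0)) | Finₚ.toℕ-↑ˡ i (t ℕ.+ 0)
                   | T⇒≡true (ℕₚ.<⇒<ᵇ (Finₚ.toℕ<n i))
                   = trans (ℚₚ.*-identityʳ _) (ℚₚ.*-identityʳ y)
  negative : (j : Fin (t ℕ.+ 0)) → w (Fin.suc (t Fin.↑ʳ j)) ≡ z
  negative j rewrite w-suc (t Fin.↑ʳ j) | Finₚ.toℕ-↑ʳ t j
                   | ¬T⇒≡false (ℕₚ.≤⇒≯ (ℕₚ.m≤m+n t (toℕ j)) ∘ ℕₚ.<ᵇ⇒< _ t)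
                   = trans (ℚₚ.*-identityˡ _) (ℚₚ.*-identityʳ z)

when-*ˡ : ∀ b c v → when b (c * v) ≡ c * when b v
when-*ˡ true  c v = refl
when-*ˡ false c v = sym (ℚₚ.*-zeroʳ c)

when-∧ : ∀ a b u v → when (a ∧ b) (u * v) ≡ when a u * when b v
when-∧ true  b u v = when-*ˡ b u v
when-∧ false b u v = sym (ℚₚ.*-zeroˡ (when b v))

coflowSum-∑ᵛ : ∀ {n} (N : OM n) q y z → coflowSum N q y z ≡ ∑ᵛ q n (λ f → when (isCoflowᵇ q N f) (weight y z f))
coflowSum-∑ᵛ N q y z = sumℚ-coflows q N (weight y z)

weight-negate : ∀ {q n} y z (f : Coflow q n) → weight y z (Vec.map negate f) ≡ weight z y f
weight-negate y z f = trans (cong₂ (λ a b → (y ^ℚ a) * (z ^ℚ b)) (#>-negate f) (#<-negate f)) (ℚₚ.*-comm (y ^ℚ #< f) (z ^ℚ #> f))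

weight-insertAt : ∀ {q m} y z (f : Coflow q m) a x → weight y z (Vec.insertAt f a x) ≡ weight y z (x ∷ []) * weight y z f
weight-insertAt y z f a x =
  trans (cong₂ (λ b c → (y ^ℚ b) * (z ^ℚ c)) (countᵇ-insertAt isPosᵇ f a x) (countᵇ-insertAt isNegᵇ f a x))
        (weight-++ y z (x ∷ []) f)

coflowSum-sym : ∀ {n} (N : OM n) q y z → coflowSum N q y z ≡ coflowSum N q z y
coflowSum-sym {n} N q y z = begin
  coflowSum N q y z                                                           ≡⟨ coflowSum-∑ᵛ N q y z ⟩
  ∑ᵛ q n (λ f → when (isCoflowᵇ q N f) (weight y z f))                        ≡⟨ ∑ᵛ-map q n negate ∑-negate _ ⟨
  ∑ᵛ q n (λ f → when (isCoflowᵇ q N (Vec.map negate f)) (weight y z (Vec.map negate f)))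
    ≡⟨ ∑ᵛ-cong q n (λ f → cong₂ when (isCoflowᵇ-negate q N f) (weight-negate y z f)) ⟩
  ∑ᵛ q n (λ f → when (isCoflowᵇ q N f) (weight z y f))                        ≡⟨ coflowSum-∑ᵛ N q z y ⟨
  coflowSum N q z y                                                           ∎

coflowSum-empty : (N : OM 0) → Regular N → ∀ q y z → coflowSum N q y z ≡ 1ℚ
coflowSum-empty []      _                    q y z = refl
coflowSum-empty (X ∷ N) (_ , _ , _ , circuits) q y z
  with _ , _ , _ , (() , _) , _ ← proj₁ (circuits X) (Any.here refl)

coflowSum-loop : ∀ {m} (N : OM (suc m)) a → Regular N → IsLoop N a →
                 ∀ k y z → coflowSum N (suc k) y z ≡ coflowSum (deletion N a) (suc k) y z
coflowSum-loop {m} N a reg loop k y z = begin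
  coflowSum N q y z                                          ≡⟨ coflowSum-∑ᵛ N q y z ⟩
  ∑ᵛ q (suc m) W                                             ≡⟨ ∑ᵛ-insertAt q m a W ⟩
  ∑ᵛ q m (λ f → ∑[ x < q ] W (Vec.insertAt f a x))           ≡⟨ ∑ᵛ-cong q m only-zero ⟩
  ∑ᵛ q m (λ f → when (isCoflowᵇ q (deletion N a) f) (weight y z f)) ≡⟨ coflowSum-∑ᵛ (deletion N a) q y z ⟨
  coflowSum (deletion N a) q y z                             ∎
  where
  q = suc k
  W = λ (g : Coflow q (suc m)) → when (isCoflowᵇ q N g) (weight y z g)
  only-zero : ∀ f → ∑[ x < q ] W (Vec.insertAt f a x) ≡ when (isCoflowᵇ q (deletion N a) f) (weight y z f)
  only-zero f = begin
    W (Vec.insertAt f a Fin.zero) + ∑[ i < k ] W (Vec.insertAt f a (Fin.suc i))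
      ≡⟨ cong₂ _+_ (cong₂ when (isCoflowᵇ-cong q (loop-coflow-zero reg loop f)) (weight-insertAt y z f a Fin.zero))
                    (trans (sum-cong-≗ (λ i → cong (λ b → when b (weight y z (Vec.insertAt f a (Fin.suc i))))
                             (¬T⇒≡false (loop-not-coflow reg loop f i ∘ Equivalence.to (isCoflowᵇ⇔IsCoflow q N _)))))
                           (sum-replicate-zero k)) ⟩
    when (isCoflowᵇ q (deletion N a) f) (1ℚ * weight y z f) + 0ℚ
      ≡⟨ ℚₚ.+-identityʳ _ ⟩
    when (isCoflowᵇ q (deletion N a) f) (1ℚ * weight y z f)
      ≡⟨ cong (when (isCoflowᵇ q (deletion N a) f)) (ℚₚ.*-identityˡ (weight y z f)) ⟩
    when (isCoflowᵇ q (deletion N a) f) (weight y z f) ∎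

coflowSum-coloop : ∀ {m} (N : OM (suc m)) a → Regular N → IsColoop N a →
                   ∀ t y z → coflowSum N (suc (2 ℕ.* t)) y z ≡ (1ℚ + ι t * (y + z)) * coflowSum (contraction N a) (suc (2 ℕ.* t)) y z
coflowSum-coloop {m} N a reg coloop t y z = begin
  coflowSum N q y z                                                  ≡⟨ coflowSum-∑ᵛ N q y z ⟩
  ∑ᵛ q (suc m) W                                                     ≡⟨ ∑ᵛ-insertAt q m a W ⟩
  ∑ᵛ q m (λ f → ∑[ x < q ] W (Vec.insertAt f a x))
    ≡⟨ ∑ᵛ-cong q m (λ f → sum-cong-≗ (λ x → trans
         (cong₂ when (isCoflowᵇ-cong q (coloop-coflow reg coloop f x)) (weight-insertAt y z f a x))
         (when-*ˡ _ (weight y z (x ∷ [])) (weight y z f)))) ⟩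
  ∑ᵛ q m (λ f → ∑[ x < q ] (weight y z (x ∷ []) * W′ f))
    ≡⟨ ∑ᵛ-cong q m (λ f → *-distribʳ-sum {q} (W′ f) (λ x → weight y z (x ∷ []))) ⟨
  ∑ᵛ q m (λ f → (∑[ x < q ] weight y z (x ∷ [])) * W′ f)
    ≡⟨ *-distribˡ-∑ᵛ q m (∑[ x < q ] weight y z (x ∷ [])) W′ ⟨
  (∑[ x < q ] weight y z (x ∷ [])) * ∑ᵛ q m W′
    ≡⟨ cong₂ _*_ (∑-weight-odd t y z) (sym (coflowSum-∑ᵛ (contraction N a) q y z)) ⟩
  (1ℚ + ι t * (y + z)) * coflowSum (contraction N a) q y z           ∎
  where
  q = suc (2 ℕ.* t)
  W = λ (g : Coflow q (suc m)) → when (isCoflowᵇ q N g) (weight y z g)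
  W′ = λ (f : Coflow q m) → when (isCoflowᵇ q (contraction N a) f) (weight y z f)

coflowSum-union : ∀ {n₁ n₂} (N₁ : OM n₁) (N₂ : OM n₂) q y z →
                  coflowSum (disjointUnion N₁ N₂) q y z ≡ coflowSum N₁ q y z * coflowSum N₂ q y z
coflowSum-union {n₁} {n₂} N₁ N₂ q y z = begin
  coflowSum (disjointUnion N₁ N₂) q y z                                   ≡⟨ coflowSum-∑ᵛ (disjointUnion N₁ N₂) q y z ⟩
  ∑ᵛ q (n₁ ℕ.+ n₂) W                                                      ≡⟨ ∑ᵛ-++ q n₁ n₂ W ⟩
  ∑ᵛ q n₁ (λ f → ∑ᵛ q n₂ (λ g → W (f Vec.++ g)))
    ≡⟨ ∑ᵛ-cong q n₁ (λ f → ∑ᵛ-cong q n₂ (λ g → trans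
         (cong₂ when (coflow-++ f g) (weight-++ y z f g))
         (when-∧ (isCoflowᵇ q N₁ f) _ (weight y z f) (weight y z g)))) ⟩
  ∑ᵛ q n₁ (λ f → ∑ᵛ q n₂ (λ g → W₁ f * W₂ g))                             ≡⟨ ∑ᵛ-* q n₁ n₂ W₁ W₂ ⟩
  ∑ᵛ q n₁ W₁ * ∑ᵛ q n₂ W₂
    ≡⟨ cong₂ _*_ (coflowSum-∑ᵛ N₁ q y z) (coflowSum-∑ᵛ N₂ q y z) ⟨
  coflowSum N₁ q y z * coflowSum N₂ q y z                                 ∎
  where
  W = λ (h : Coflow q (n₁ ℕ.+ n₂)) → when (isCoflowᵇ q (disjointUnion N₁ N₂) h) (weight y z h)
  W₁ = λ (f : Coflow q n₁) → when (isCoflowᵇ q N₁ f) (weight y z f)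
  W₂ = λ (g : Coflow q n₂) → when (isCoflowᵇ q N₂ g) (weight y z g)
  coflow-++ : ∀ f g → isCoflowᵇ q (disjointUnion N₁ N₂) (f Vec.++ g) ≡ isCoflowᵇ q N₁ f ∧ isCoflowᵇ q N₂ g
  coflow-++ f g = T-injective (⇔.trans (isCoflowᵇ⇔IsCoflow q _ (f Vec.++ g)) (⇔.trans (union-coflow q N₁ N₂ f g)
    (⇔.sym (⇔.trans Boolₚ.T-∧ (isCoflowᵇ⇔IsCoflow q N₁ f ×-⇔ isCoflowᵇ⇔IsCoflow q N₂ g)))))

coflowSum3-homogenise : ∀ {n} (N : OM n) t x y z .{{_ : NonZero x}} →
  coflowSum3 N (suc (2 ℕ.* t)) x y z ≡ (x ^ℚ n) * coflowSum N (suc (2 ℕ.* t)) (y ÷ x) (z ÷ x)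
coflowSum3-homogenise {n} N t x y z = begin
  coflowSum3 N q x y z
    ≡⟨ sumℚ-coflows q N (λ f → (x ^ℚ #= f) * (y ^ℚ #> f) * (z ^ℚ #< f)) ⟩
  ∑ᵛ q n (λ f → when (isCoflowᵇ q N f) ((x ^ℚ #= f) * (y ^ℚ #> f) * (z ^ℚ #< f)))
    ≡⟨ ∑ᵛ-cong q n (λ f → trans (cong (when (isCoflowᵇ q N f)) (trans
         (homogenise x y z (#= f) (#> f) (#< f))
         (cong (λ k → (x ^ℚ k) * weight (y ÷ x) (z ÷ x) f) (#=+#>+#<-odd t f))))
         (when-*ˡ (isCoflowᵇ q N f) (x ^ℚ n) _)) ⟩
  ∑ᵛ q n (λ f → (x ^ℚ n) * when (isCoflowᵇ q N f) (weight (y ÷ x) (z ÷ x) f))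
    ≡⟨ *-distribˡ-∑ᵛ q n (x ^ℚ n) _ ⟨
  (x ^ℚ n) * ∑ᵛ q n (λ f → when (isCoflowᵇ q N f) (weight (y ÷ x) (z ÷ x) f))
    ≡⟨ cong ((x ^ℚ n) *_) (coflowSum-∑ᵛ N q (y ÷ x) (z ÷ x)) ⟨
  (x ^ℚ n) * coflowSum N q (y ÷ x) (z ÷ x) ∎
  where q = suc (2 ℕ.* t)

coflowSum≥≤-dualise : ∀ {n} (N : OM n) t y z .{{_ : NonZero y}} .{{_ : NonZero z}} →
  coflowSum≥≤ N (suc (2 ℕ.* t)) y z ≡ ((y * z) ^ℚ n) * coflowSum N (suc (2 ℕ.* t)) (1ℚ ÷ y) (1ℚ ÷ z)
coflowSum≥≤-dualise {n} N t y z = begin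
  coflowSum≥≤ N q y z
    ≡⟨ sumℚ-coflows q N (λ f → (y ^ℚ #≥ f) * (z ^ℚ #≤ f)) ⟩
  ∑ᵛ q n (λ f → when (isCoflowᵇ q N f) ((y ^ℚ #≥ f) * (z ^ℚ #≤ f)))
    ≡⟨ ∑ᵛ-cong q n (λ f → trans (cong (when (isCoflowᵇ q N f)) (begin
         (y ^ℚ #≥ f) * (z ^ℚ #≤ f)
           ≡⟨ cong₂ (λ a b → (y ^ℚ a) * (z ^ℚ b)) (#≥≡#>+#= f) (#≤≡#<+#= f) ⟩
         (y ^ℚ (#> f ℕ.+ #= f)) * (z ^ℚ (#< f ℕ.+ #= f))
           ≡⟨ dualise y z (#= f) (#> f) (#< f) ⟩
         ((y * z) ^ℚ (#= f ℕ.+ #> f ℕ.+ #< f)) * weight (1ℚ ÷ z) (1ℚ ÷ y) f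
           ≡⟨ cong (λ k → ((y * z) ^ℚ k) * weight (1ℚ ÷ z) (1ℚ ÷ y) f) (#=+#>+#<-odd t f) ⟩
         ((y * z) ^ℚ n) * weight (1ℚ ÷ z) (1ℚ ÷ y) f ∎))
         (when-*ˡ (isCoflowᵇ q N f) ((y * z) ^ℚ n) _)) ⟩
  ∑ᵛ q n (λ f → ((y * z) ^ℚ n) * when (isCoflowᵇ q N f) (weight (1ℚ ÷ z) (1ℚ ÷ y) f))
    ≡⟨ *-distribˡ-∑ᵛ q n ((y * z) ^ℚ n) _ ⟨
  ((y * z) ^ℚ n) * ∑ᵛ q n (λ f → when (isCoflowᵇ q N f) (weight (1ℚ ÷ z) (1ℚ ÷ y) f))
    ≡⟨ cong (((y * z) ^ℚ n) *_) (trans (sym (coflowSum-∑ᵛ N q (1ℚ ÷ z) (1ℚ ÷ y))) (coflowSum-sym N q (1ℚ ÷ z) (1ℚ ÷ y))) ⟩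
  ((y * z) ^ℚ n) * coflowSum N q (1ℚ ÷ y) (1ℚ ÷ z) ∎
  where q = suc (2 ℕ.* t)

A-symmetric : (n : ℕ) (N : OM n) → Regular N → (P : Poly3) → IsAPoly N P →
              (q y z : ℚ) → eval P q y z ≡ eval P q z y
A-symmetric n N _ P P-A q y z = trans (eval-unique P (swapYZ P) P≡swapYZ-P q y z) (eval-swapYZ P q y z)
  where
  P≡swapYZ-P : ∀ q → OddPos q → ∀ y z → eval P (ι q) y z ≡ eval (swapYZ P) (ι q) y z
  P≡swapYZ-P q odd y z = begin
    eval P (ι q) y z           ≡⟨ P-A q odd y z ⟩
    coflowSum N q y z          ≡⟨ coflowSum-sym N q y z ⟩
    coflowSum N q z y          ≡⟨ P-A q odd z y ⟨
    eval P (ι q) z y           ≡⟨ eval-swapYZ P (ι q) y z ⟨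
    eval (swapYZ P) (ι q) y z  ∎

A-homogenised : (n : ℕ) (N : OM n) → Regular N → (P : Poly3) → IsAPoly N P →
                (q : ℕ) → OddPos q → (x y z : ℚ) → .{{_ : NonZero x}} →
                coflowSum3 N q x y z ≡ (x ^ℚ n) * eval P (+ q / 1) (y ÷ x) (z ÷ x)
A-homogenised n N _ P P-A q (t , refl) x y z =
  trans (coflowSum3-homogenise N t x y z) (cong ((x ^ℚ n) *_) (sym (P-A q (t , refl) (y ÷ x) (z ÷ x))))

A-dual : (n : ℕ) (N : OM n) → Regular N → (P : Poly3) → IsAPoly N P →
         (q : ℕ) → OddPos q → (y z : ℚ) → .{{_ : NonZero y}} → .{{_ : NonZero z}} →
         coflowSum≥≤ N q y z ≡ ((y * z) ^ℚ n) * eval P (+ q / 1) (1ℚ ÷ y) (1ℚ ÷ z)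
A-dual n N _ P P-A q (t , refl) y z =
  trans (coflowSum≥≤-dualise N t y z) (cong (((y * z) ^ℚ n) *_) (sym (P-A q (t , refl) (1ℚ ÷ y) (1ℚ ÷ z))))

A-empty : (N : OM 0) → Regular N → (P : Poly3) → IsAPoly N P →
          (q y z : ℚ) → eval P q y z ≡ 1ℚ
A-empty N reg P P-A = eval-unique P 1ᴾ (λ q odd y z → trans (P-A q odd y z) (coflowSum-empty N reg q y z))

A-loop : (m : ℕ) (N : OM (suc m)) → Regular N → (a : Fin (suc m)) → IsLoop N a →
         (P P′ : Poly3) → IsAPoly N P → IsAPoly (deletion N a) P′ →
         (q y z : ℚ) → eval P q y z ≡ eval P′ q y z
A-loop m N reg a loop P P′ P-A P′-A = eval-unique P P′ λ where
  q (t , refl) y z → trans (P-A q (t , refl) y z)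
    (trans (coflowSum-loop N a reg loop (2 ℕ.* t) y z) (sym (P′-A q (t , refl) y z)))

A-coloop : (m : ℕ) (N : OM (suc m)) → Regular N → (a : Fin (suc m)) → IsColoop N a →
           (P P′ : Poly3) → IsAPoly N P → IsAPoly (contraction N a) P′ →
           (q y z : ℚ) → eval P q y z ≡ (1ℚ + ((q - 1ℚ) * ½) * (y + z)) * eval P′ q y z
A-coloop m N reg a coloop P P′ P-A P′-A q y z = begin
  eval P q y z                                        ≡⟨ eval-unique P (coloopFactor *ᴾ P′) P≡factor*P′ q y z ⟩
  eval (coloopFactor *ᴾ P′) q y z                     ≡⟨ eval-*ᴾ coloopFactor P′ q y z ⟩
  eval coloopFactor q y z * eval P′ q y z             ≡⟨ cong (_* eval P′ q y z) (eval-coloopFactor q y z) ⟩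
  (1ℚ + ((q - 1ℚ) * ½) * (y + z)) * eval P′ q y z     ∎
  where
  P≡factor*P′ : ∀ q → OddPos q → ∀ y z → eval P (ι q) y z ≡ eval (coloopFactor *ᴾ P′) (ι q) y z
  P≡factor*P′ q (t , refl) y z = begin
    eval P (ι q) y z                                          ≡⟨ P-A q (t , refl) y z ⟩
    coflowSum N q y z                                         ≡⟨ coflowSum-coloop N a reg coloop t y z ⟩
    (1ℚ + ι t * (y + z)) * coflowSum (contraction N a) q y z
      ≡⟨ cong₂ _*_ (trans (cong (λ h → 1ℚ + h * (y + z)) (sym (odd-half t))) (sym (eval-coloopFactor (ι q) y z)))
                   (sym (P′-A q (t , refl) y z)) ⟩
    eval coloopFactor (ι q) y z * eval P′ (ι q) y z           ≡⟨ eval-*ᴾ coloopFactor P′ (ι q) y z ⟨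
    eval (coloopFactor *ᴾ P′) (ι q) y z                       ∎

A-disjointUnion : (n₁ n₂ : ℕ) (N₁ : OM n₁) (N₂ : OM n₂) → Regular N₁ → Regular N₂ →
                  Regular (disjointUnion N₁ N₂) →
                  (P P₁ P₂ : Poly3) → IsAPoly (disjointUnion N₁ N₂) P →
                  IsAPoly N₁ P₁ → IsAPoly N₂ P₂ →
                  (q y z : ℚ) → eval P q y z ≡ eval P₁ q y z * eval P₂ q y z
A-disjointUnion n₁ n₂ N₁ N₂ _ _ _ P P₁ P₂ P-A P₁-A P₂-A q y z =
  trans (eval-unique P (P₁ *ᴾ P₂) P≡P₁*P₂ q y z) (eval-*ᴾ P₁ P₂ q y z)
  where
  P≡P₁*P₂ : ∀ q → OddPos q → ∀ y z → eval P (ι q) y z ≡ eval (P₁ *ᴾ P₂) (ι q) y z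
  P≡P₁*P₂ q odd y z = begin
    eval P (ι q) y z                              ≡⟨ P-A q odd y z ⟩
    coflowSum (disjointUnion N₁ N₂) q y z         ≡⟨ coflowSum-union N₁ N₂ q y z ⟩
    coflowSum N₁ q y z * coflowSum N₂ q y z       ≡⟨ cong₂ _*_ (P₁-A q odd y z) (P₂-A q odd y z) ⟨
    eval P₁ (ι q) y z * eval P₂ (ι q) y z         ≡⟨ eval-*ᴾ P₁ P₂ (ι q) y z ⟨
    eval (P₁ *ᴾ P₂) (ι q) y z                     ∎


proposition3p4 :
    ((n : ℕ) (N : OM n) → Regular N → (P : Poly3) → IsAPoly N P →
       (q y z : ℚ) → eval P q y z ≡ eval P q z y)
    ×
    ((n : ℕ) (N : OM n) → Regular N → (P : Poly3) → IsAPoly N P →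
       (q : ℕ) → OddPos q → (x y z : ℚ) → .{{_ : NonZero x}} →
       coflowSum3 N q x y z ≡ (x ^ℚ n) * eval P (+ q / 1) (y ÷ x) (z ÷ x))
    ×
    ((n : ℕ) (N : OM n) → Regular N → (P : Poly3) → IsAPoly N P →
       (q : ℕ) → OddPos q → (y z : ℚ) → .{{_ : NonZero y}} → .{{_ : NonZero z}} →
       coflowSum≥≤ N q y z ≡ ((y * z) ^ℚ n) * eval P (+ q / 1) (1ℚ ÷ y) (1ℚ ÷ z))
    ×
    ((N : OM 0) → Regular N → (P : Poly3) → IsAPoly N P →
       (q y z : ℚ) → eval P q y z ≡ 1ℚ)
    ×
    ((m : ℕ) (N : OM (suc m)) → Regular N → (a : Fin (suc m)) → IsLoop N a →
       (P P' : Poly3) → IsAPoly N P → IsAPoly (deletion N a) P' →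
       (q y z : ℚ) → eval P q y z ≡ eval P' q y z)
    ×
    ((m : ℕ) (N : OM (suc m)) → Regular N → (a : Fin (suc m)) → IsColoop N a →
       (P P' : Poly3) → IsAPoly N P → IsAPoly (contraction N a) P' →
       (q y z : ℚ) →
       eval P q y z ≡ (1ℚ + ((q - 1ℚ) * ½) * (y + z)) * eval P' q y z)
    ×
    ((n₁ n₂ : ℕ) (N₁ : OM n₁) (N₂ : OM n₂) → Regular N₁ → Regular N₂ →
       Regular (disjointUnion N₁ N₂) →
       (P P₁ P₂ : Poly3) → IsAPoly (disjointUnion N₁ N₂) P →
       IsAPoly N₁ P₁ → IsAPoly N₂ P₂ →
       (q y z : ℚ) → eval P q y z ≡ eval P₁ q y z * eval P₂ q y z)
proposition3p4 = A-symmetric , A-homogenised , A-dual , A-empty , A-loop , A-coloop , A-disjointUnion
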